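{- Let $m\geqslant 2$ and $1\leqslant\ell<m$. Then $\#Y_{m,R}(\ell)=\#Y_{m,L}(\ell)=m(1+\ell m-\ell)-\frac{m}{2}\ell(\ell-1)$. In particular, $\#Y_m(\ell)=2m(1+\ell m-\ell)-m\ell(\ell-1)$.
   Context: $\mathcal{A}_m=\{0,\ldots,m-1\}=\mathbb{Z}/m\mathbb{Z}$; $\sigma_m$ is the morphism $\sigma_m(i)=i\,(i+1)\cdots(i+m-1)$ (letters mod $m$), and $\mathbf{t}_m=\lim_{j\to\infty}\sigma_m^j(0)$. $\Psi(w)$ is the Parikh vector of $w$. Define $Y_{m,R}(\ell)=\{(\Psi(U),a)\mid a\in\mathcal{A}_m,\ Ua \text{ a factor of length } \ell+1 \text{ of } \mathbf{t}_m\}$, $Y_{m,L}(\ell)=\{(a,\Psi(U))\mid a\in\mathcal{A}_m,\ aU\text{ a factor of length }\ell+1\text{ of }\mathbf{t}_m\}$, and $Y_m(\ell)=Y_{m,R}(\ell)\cup Y_{m,L}(\ell)$ (the two sets consisting of pairs of different types, i.e. considered disjoint). -}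

module Defs where

open import Data.Nat using (ℕ; zero; suc; _+_; _*_; _%_; NonZero; >-nonZero⁻¹)
open import Data.Nat.DivMod using (m%n<n)
open import Data.Fin using (Fin; toℕ; fromℕ<; _≟_)
open import Data.List using (List; []; _∷_; map; concatMap; upTo; length; filter)
open import Data.Vec using (Vec; tabulate)
open import Data.Product using (Σ; ∃; _×_; _,_)
open import Function.Bundles using (_⇔_)
open import Data.List.Membership.Propositional using (_∈_)
open import Data.List.Relation.Unary.Unique.Propositional using (Unique)
open import Data.Sum using (_⊎_; inj₁; inj₂)
open import Relation.Binary.PropositionalEquality using (_≡_)
open import Data.List using (_++_)

module _ (m : ℕ) .{{_ : NonZero m}} where

  letter0 : Fin m
  letter0 = fromℕ< (>-nonZero⁻¹ m)

  _⊕_ : Fin m → ℕ → Fin m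
  i ⊕ k = fromℕ< (m%n<n (toℕ i + k) m)

  σ : Fin m → List (Fin m)
  σ i = map (i ⊕_) (upTo m)

  σ* : List (Fin m) → List (Fin m)
  σ* = concatMap σ

  σpow : ℕ → List (Fin m)
  σpow zero    = letter0 ∷ []
  σpow (suc j) = σ* (σpow j)

  -- n-th letter of a word (default letter0 if out of range)
  nth : List (Fin m) → ℕ → Fin m
  nth []       _       = letter0
  nth (x ∷ xs) zero    = x
  nth (x ∷ xs) (suc n) = nth xs n

  -- t_m = lim_j σ_m^j(0): the n-th letter of t_m is the n-th letter of
  -- σ_m^(n+1)(0), which has length m^(n+1) > n (σ_m(0) begins with 0, so
  -- the σ_m^j(0) are successive prefixes of t_m).
  t : ℕ → Fin m
  t n = nth (σpow (suc n)) n

  factorAt : ℕ → ℕ → List (Fin m)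
  factorAt i n = map (λ k → t (i + k)) (upTo n)

  Ψ : List (Fin m) → Vec ℕ m
  Ψ w = tabulate (λ a → length (filter (a ≟_) w))

  InYR : ℕ → Vec ℕ m × Fin m → Set
  InYR ℓ (v , a) = Σ (List (Fin m)) λ U → Σ ℕ λ i →
    (factorAt i (suc ℓ) ≡ U ++ (a ∷ [])) × (Ψ U ≡ v)

  InYL : ℕ → Fin m × Vec ℕ m → Set
  InYL ℓ (a , v) = Σ (List (Fin m)) λ U → Σ ℕ λ i →
    (factorAt i (suc ℓ) ≡ a ∷ U) × (Ψ U ≡ v)

  -- Y_m(ℓ) = Y_{m,R}(ℓ) ∪ Y_{m,L}(ℓ), a disjoint union (elements of different types)
  InY : ℕ → (Vec ℕ m × Fin m) ⊎ (Fin m × Vec ℕ m) → Set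
  InY ℓ (inj₁ y) = InYR ℓ y
  InY ℓ (inj₂ y) = InYL ℓ y

HasSize : {A : Set} → (A → Set) → ℕ → Set
HasSize {A} P n = Σ (List A) λ L → Unique L × (∀ y → (y ∈ L) ⇔ P y) × (length L ≡ n)

{-# OPTIONS --safe #-}
-- Since t_m(mq + r) = t_m(q) + r for r < m, a factor of length ℓ + 1 ≤ m lies in at most two
-- consecutive blocks σ_m(t_m(q)), so it is a run c (c+1) … (c+p−1) of consecutive letters
-- followed by a second run d (d+1) …; conversely every such word occurs, because any two
-- letters are adjacent somewhere in t_m. Write such a factor as Ua. Measured from a, Ψ(U) is
-- the sum of the indicators of a cyclic interval [x, x + ℓ − q) and of the interval [−q, 0)
-- just before a. Merging the two intervals when they touch, and exchanging their roles when
-- the first starts inside the second, leaves exactly one pair (q, x) per Parikh vector: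
-- m pairs with q = 0 and m − q − 1 for each 1 ≤ q < ℓ. Reversing a factor and negating its
-- letters preserves the set of factors and exchanges Y_{m,R}(ℓ) with Y_{m,L}(ℓ).
module Submission where

open import Defs
open import Data.Empty using (⊥)
open import Data.Fin as Fin using (Fin; toℕ)
open import Data.Fin.Properties using (toℕ-injective; toℕ-fromℕ<; toℕ<n)
open import Data.List
  using (List; []; _∷_; _++_; _∷ʳ_; map; applyUpTo; upTo; length; reverse; filter; cartesianProduct; allFin)
open import Data.List.Properties
  using ( length-tabulate; length-applyUpTo; length-upTo; length-map; length-++; applyUpTo-∷ʳ; map-upTo
        ; concatMap-++; ++-identityʳ; ++-assoc; map-++; reverse-++; filter-++; ∷ʳ-injective)
open import Data.List.Membership.Propositional using (_∈_; _∉_)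
open import Data.List.Membership.Propositional.Properties
  using ( ∈-applyUpTo⁺; ∈-applyUpTo⁻; ∈-upTo⁺; ∈-upTo⁻; ∈-++⁺ˡ; ∈-++⁺ʳ; ∈-++⁻; ∈-map⁺; ∈-map⁻
        ; ∈-cartesianProduct⁺; ∈-cartesianProduct⁻; ∈-allFin)
open import Data.List.Relation.Binary.Permutation.Propositional using (_↭_; ↭-reflexive; module PermutationReasoning)
import Data.List.Relation.Binary.Permutation.Propositional.Properties as ↭
open import Data.List.Relation.Binary.Permutation.Propositional.Properties using (↭-length; filter-↭; ↭-reverse; shifts)
import Data.List.Relation.Unary.All as All
open import Data.List.Relation.Unary.Any using (here; there)
open import Data.List.Relation.Unary.Unique.Propositional using (Unique; []; _∷_)
open import Data.List.Relation.Unary.Unique.Propositional.Properties as Unique using (Unique[x∷xs]⇒x∉xs)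
open import Data.Nat
  using (ℕ; zero; suc; pred; _+_; _*_; _∸_; _/_; _%_; _^_; _≤_; _<_; _≟_; _≤?_; _<?_; z≤n; s≤s; s≤s⁻¹; z<s; NonZero; >-nonZero⁻¹)
open import Data.Nat.DivMod
open import Data.Nat.Properties
open import Data.Nat.Tactic.RingSolver using (solve-∀)
open import Data.Product using (∃; _×_; _,_; proj₁; proj₂)
open import Data.Sum using (_⊎_; inj₁; inj₂)
open import Data.Sum.Properties using (inj₁-injective; inj₂-injective)
open import Data.Vec using (Vec; tabulate; lookup)
open import Data.Vec.Properties using (tabulate-cong; lookup∘tabulate; tabulate∘lookup)
open import Function using (_∘_)
open import Function.Bundles using (Equivalence; mk⇔)
open import Relation.Binary.Definitions using (tri<; tri≈; tri>)
open import Relation.Binary.PropositionalEquality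
  using (_≡_; _≢_; refl; sym; trans; cong; cong₂; subst; module ≡-Reasoning)
open import Relation.Nullary using (¬_; yes; no; contradiction)

module _ {A : Set} where

  applyUpTo-cong : ∀ {f g : ℕ → A} n → (∀ k → k < n → f k ≡ g k) → applyUpTo f n ≡ applyUpTo g n
  applyUpTo-cong zero    f≗g = refl
  applyUpTo-cong (suc n) f≗g = cong₂ _∷_ (f≗g 0 (s≤s z≤n)) (applyUpTo-cong n (λ k k<n → f≗g (suc k) (s≤s k<n)))

  applyUpTo-+ : ∀ (f : ℕ → A) j k → applyUpTo f (j + k) ≡ applyUpTo f j ++ applyUpTo (λ i → f (j + i)) k
  applyUpTo-+ f zero    k = refl
  applyUpTo-+ f (suc j) k = cong (f 0 ∷_) (applyUpTo-+ (f ∘ suc) j k)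

module _ {A B : Set} where

  Unique-map⁺ : ∀ {f : A → B} {xs} → (∀ {x y} → x ∈ xs → y ∈ xs → f x ≡ f y → x ≡ y) → Unique xs → Unique (map f xs)
  Unique-map⁺ {xs = []}     _     _            = []
  Unique-map⁺ {f} {x ∷ xs} f-inj (x∉xs ∷ uxs) =
    All.tabulate fx∉ ∷ Unique-map⁺ (λ x∈ y∈ → f-inj (there x∈) (there y∈)) uxs
    where
      fx∉ : ∀ {z} → z ∈ map f xs → f x ≢ z
      fx∉ z∈ fx≡z with ∈-map⁻ f z∈
      ... | y , y∈xs , refl = All.lookup x∉xs y∈xs (f-inj (here refl) (there y∈xs) fx≡z)

  length-cartesianProduct : ∀ (xs : List A) (ys : List B) → length (cartesianProduct xs ys) ≡ length xs * length ys
  length-cartesianProduct []       ys = refl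
  length-cartesianProduct (x ∷ xs) ys = begin
    length (map (x ,_) ys ++ cartesianProduct xs ys)           ≡⟨ length-++ (map (x ,_) ys) ⟩
    length (map (x ,_) ys) + length (cartesianProduct xs ys)   ≡⟨ cong₂ _+_ (length-map (x ,_) ys) (length-cartesianProduct xs ys) ⟩
    length ys + length xs * length ys                          ∎
    where open ≡-Reasoning

  HasSize-bijection : ∀ {P : A → Set} {Q : B → Set} {n} (f : A → B) (g : B → A) →
                      (∀ x → g (f x) ≡ x) → (∀ y → f (g y) ≡ y) →
                      (∀ x → P x → Q (f x)) → (∀ y → Q y → P (g y)) → HasSize P n → HasSize Q n
  HasSize-bijection {P} {Q} f g g∘f f∘g P⇒Q Q⇒P (xs , uxs , ∈xs⇔P , length≡n) =
    map f xs , Unique.map⁺ f-injective uxs , (λ y → mk⇔ (⇒Q y) (⇐Q y)) , trans (length-map f xs) length≡n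
    where
      f-injective : ∀ {x y} → f x ≡ f y → x ≡ y
      f-injective {x} {y} fx≡fy = trans (sym (g∘f x)) (trans (cong g fx≡fy) (g∘f y))
      ⇒Q : ∀ y → y ∈ map f xs → Q y
      ⇒Q y y∈ with ∈-map⁻ f y∈
      ... | x , x∈xs , refl = P⇒Q x (Equivalence.to (∈xs⇔P x) x∈xs)
      ⇐Q : ∀ y → Q y → y ∈ map f xs
      ⇐Q y Qy = subst (_∈ map f xs) (f∘g y) (∈-map⁺ f (Equivalence.from (∈xs⇔P (g y)) (Q⇒P y Qy)))

  HasSize-⊎ : ∀ {R : A ⊎ B → Set} {n k} → HasSize (R ∘ inj₁) n → HasSize (R ∘ inj₂) k → HasSize R (n + k)
  HasSize-⊎ {R} (xs , uxs , ∈xs⇔ , length-xs) (ys , uys , ∈ys⇔ , length-ys) =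
    zs , Unique.++⁺ (Unique.map⁺ inj₁-injective uxs) (Unique.map⁺ inj₂-injective uys) (λ (z∈ˡ , z∈ʳ) → disjoint z∈ˡ z∈ʳ) ,
    (λ z → mk⇔ (⇒R z) (⇐R z)) ,
    trans (length-++ (map inj₁ xs)) (cong₂ _+_ (trans (length-map inj₁ xs) length-xs) (trans (length-map inj₂ ys) length-ys))
    where
      zs = map inj₁ xs ++ map inj₂ ys
      disjoint : ∀ {z} → z ∈ map inj₁ xs → z ∉ map inj₂ ys
      disjoint z∈ˡ z∈ʳ with ∈-map⁻ inj₁ z∈ˡ | ∈-map⁻ inj₂ z∈ʳ
      ... | _ , _ , refl | _ , _ , ()
      ⇒R : ∀ z → z ∈ zs → R z
      ⇒R z z∈ with ∈-++⁻ (map inj₁ xs) z∈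
      ... | inj₁ z∈ˡ with ∈-map⁻ inj₁ z∈ˡ
      ...   | x , x∈ , refl = Equivalence.to (∈xs⇔ x) x∈
      ⇒R z z∈ | inj₂ z∈ʳ with ∈-map⁻ inj₂ z∈ʳ
      ...   | y , y∈ , refl = Equivalence.to (∈ys⇔ y) y∈
      ⇐R : ∀ z → R z → z ∈ zs
      ⇐R (inj₁ x) Rz = ∈-++⁺ˡ (∈-map⁺ inj₁ (Equivalence.from (∈xs⇔ x) Rz))
      ⇐R (inj₂ y) Rz = ∈-++⁺ʳ (map inj₁ xs) (∈-map⁺ inj₂ (Equivalence.from (∈ys⇔ y) Rz))

2*L+ℓ*[ℓ∸1]≡2*[1+ℓ*m∸ℓ] : ∀ {m ℓ L} → 0 < m → 1 ≤ ℓ → 2 * L + (ℓ ∸ 1) * (ℓ ∸ 1 + 3) ≡ 2 * suc (ℓ ∸ 1) * m →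
                    2 * L + ℓ * (ℓ ∸ 1) ≡ 2 * (1 + ℓ * m ∸ ℓ)
2*L+ℓ*[ℓ∸1]≡2*[1+ℓ*m∸ℓ] {suc k} {suc l} {L} _ _ counted = +-cancelʳ-≡ (2 * l) _ _ (begin
  2 * L + suc l * l + 2 * l                ≡⟨ regroup L l ⟩
  2 * L + l * (l + 3)                      ≡⟨ counted ⟩
  2 * suc l * suc k                        ≡⟨ expand l k ⟩
  2 * (1 + suc l * k) + 2 * l              ≡⟨ cong (λ z → 2 * z + 2 * l) drop-ℓ ⟨
  2 * (1 + suc l * suc k ∸ suc l) + 2 * l  ∎)
  where
    open ≡-Reasoning
    regroup : ∀ L l → 2 * L + suc l * l + 2 * l ≡ 2 * L + l * (l + 3)
    regroup = solve-∀
    expand : ∀ l k → 2 * suc l * suc k ≡ 2 * (1 + suc l * k) + 2 * l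
    expand = solve-∀
    split-ℓ : ∀ l k → 1 + suc l * suc k ≡ suc l + (1 + suc l * k)
    split-ℓ = solve-∀
    drop-ℓ : 1 + suc l * suc k ∸ suc l ≡ 1 + suc l * k
    drop-ℓ = trans (cong (_∸ suc l) (split-ℓ l k)) (m+n∸m≡n (suc l) (1 + suc l * k))

m*L≡m*A∸[m*D]/2 : ∀ m {L A D} → 2 * L + D ≡ 2 * A → m * L ≡ m * A ∸ (m * D) / 2
m*L≡m*A∸[m*D]/2 m {L} {A} {D} 2L+D≡2A = sym (begin
  m * A ∸ (m * D) / 2          ≡⟨ cong₂ _∸_ (cong (m *_) (sym L+Z≡A)) (cong (λ d → (m * d) / 2) D≡2Z) ⟩
  m * (L + Z) ∸ (m * (2 * Z)) / 2 ≡⟨ cong₂ _∸_ (*-distribˡ-+ m L Z) (cong (_/ 2) (swap m Z)) ⟩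
  m * L + m * Z ∸ (m * Z * 2) / 2 ≡⟨ cong (m * L + m * Z ∸_) (m*n/n≡m (m * Z) 2) ⟩
  m * L + m * Z ∸ m * Z          ≡⟨ m+n∸n≡m (m * L) (m * Z) ⟩
  m * L                          ∎)
  where
    open ≡-Reasoning
    Z = A ∸ L
    L+Z≡A : L + Z ≡ A
    L+Z≡A = m+[n∸m]≡n {L} {A} (*-cancelˡ-≤ 2 (subst (2 * L ≤_) 2L+D≡2A (m≤m+n (2 * L) D)))
    D≡2Z : D ≡ 2 * Z
    D≡2Z = +-cancelˡ-≡ (2 * L) _ _ (trans 2L+D≡2A (trans (cong (2 *_) (sym L+Z≡A)) (*-distribˡ-+ 2 L Z)))
    swap : ∀ m Z → m * (2 * Z) ≡ m * Z * 2
    swap = solve-∀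

m*L+m*L≡2*m*A∸m*D : ∀ m {L A D} → 2 * L + D ≡ 2 * A → m * L + m * L ≡ 2 * m * A ∸ m * D
m*L+m*L≡2*m*A∸m*D m {L} {A} {D} 2L+D≡2A = sym (begin
  2 * m * A ∸ m * D                ≡⟨ cong (_∸ m * D) (reassociate m A) ⟩
  m * (2 * A) ∸ m * D              ≡⟨ cong (λ k → m * k ∸ m * D) 2L+D≡2A ⟨
  m * (2 * L + D) ∸ m * D          ≡⟨ cong (_∸ m * D) (distribute m L D) ⟩
  m * L + m * L + m * D ∸ m * D    ≡⟨ m+n∸n≡m (m * L + m * L) (m * D) ⟩
  m * L + m * L                    ∎)
  where
    open ≡-Reasoning
    reassociate : ∀ m A → 2 * m * A ≡ m * (2 * A)
    reassociate = solve-∀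
    distribute : ∀ m L D → m * (2 * L + D) ≡ m * L + m * L + m * D
    distribute = solve-∀

module _ (m : ℕ) .{{_ : NonZero m}} where

  open import Data.List.Membership.DecPropositional (Fin._≟_ {m}) using (_∈?_)

  -- Letters modulo m

  0<m : 0 < m
  0<m = >-nonZero⁻¹ m

  infixl 6 _⊞_
  _⊞_ : Fin m → ℕ → Fin m
  _⊞_ = _⊕_ m

  toℕ-⊞ : ∀ c k → toℕ (c ⊞ k) ≡ (toℕ c + k) % m
  toℕ-⊞ c k = toℕ-fromℕ< _

  [i%m+k]%m≡[i+k]%m : ∀ i k → (i % m + k) % m ≡ (i + k) % m
  [i%m+k]%m≡[i+k]%m i k = begin
    (i % m + k) % m          ≡⟨ %-distribˡ-+ (i % m) k m ⟩
    (i % m % m + k % m) % m  ≡⟨ cong (λ z → (z + k % m) % m) (m%n%n≡m%n i m) ⟩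
    (i % m + k % m) % m      ≡⟨ %-distribˡ-+ i k m ⟨
    (i + k) % m              ∎
    where open ≡-Reasoning

  ⊞-≡ : ∀ c j d k → (toℕ c + j) % m ≡ (toℕ d + k) % m → c ⊞ j ≡ d ⊞ k
  ⊞-≡ c j d k e = toℕ-injective (trans (toℕ-⊞ c j) (trans e (sym (toℕ-⊞ d k))))

  ⊞-assoc : ∀ c j k → c ⊞ j ⊞ k ≡ c ⊞ (j + k)
  ⊞-assoc c j k = ⊞-≡ (c ⊞ j) k c (j + k) (begin
    (toℕ (c ⊞ j) + k) % m    ≡⟨ cong (λ z → (z + k) % m) (toℕ-⊞ c j) ⟩
    ((toℕ c + j) % m + k) % m ≡⟨ [i%m+k]%m≡[i+k]%m (toℕ c + j) k ⟩
    (toℕ c + j + k) % m      ≡⟨ cong (_% m) (+-assoc (toℕ c) j k) ⟩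
    (toℕ c + (j + k)) % m    ∎)
    where open ≡-Reasoning

  ⊞-identityʳ : ∀ c → c ⊞ 0 ≡ c
  ⊞-identityʳ c = toℕ-injective (begin
    toℕ (c ⊞ 0)       ≡⟨ toℕ-⊞ c 0 ⟩
    (toℕ c + 0) % m   ≡⟨ cong (_% m) (+-identityʳ (toℕ c)) ⟩
    toℕ c % m         ≡⟨ m<n⇒m%n≡m (toℕ<n c) ⟩
    toℕ c             ∎)
    where open ≡-Reasoning

  ⊞-periodic : ∀ c j k → c ⊞ (j + k * m) ≡ c ⊞ j
  ⊞-periodic c j k = ⊞-≡ c (j + k * m) c j (trans (cong (_% m) (sym (+-assoc (toℕ c) j (k * m)))) ([m+kn]%n≡m%n (toℕ c + j) k m))

  ⊞-+m : ∀ c j → c ⊞ (j + m) ≡ c ⊞ j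
  ⊞-+m c j = trans (cong (λ z → c ⊞ (j + z)) (sym (*-identityˡ m))) (⊞-periodic c j 1)

  ⊞-m : ∀ c → c ⊞ m ≡ c
  ⊞-m c = trans (⊞-+m c 0) (⊞-identityʳ c)

  ⊞-∸-m : ∀ c k → k ≤ m → c ⊞ k ⊞ (m ∸ k) ≡ c
  ⊞-∸-m c k k≤m = trans (⊞-assoc c k (m ∸ k)) (trans (cong (c ⊞_) (m+[n∸m]≡n k≤m)) (⊞-m c))

  toℕ-letter0⊞ : ∀ k → toℕ (letter0 m ⊞ k) ≡ k % m
  toℕ-letter0⊞ k = trans (toℕ-⊞ (letter0 m) k) (cong (λ z → (z + k) % m) (toℕ-fromℕ< _))

  ⊞-m∸ : ∀ c k → k ≤ m → c ⊞ (m ∸ k) ⊞ k ≡ c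
  ⊞-m∸ c k k≤m = trans (⊞-assoc c (m ∸ k) k) (trans (cong (c ⊞_) (m∸n+n≡m k≤m)) (⊞-m c))

  letter0-⊞ : ∀ c → letter0 m ⊞ toℕ c ≡ c
  letter0-⊞ c = toℕ-injective (trans (toℕ-letter0⊞ (toℕ c)) (m<n⇒m%n≡m (toℕ<n c)))

  ⊞-cancelʳ : ∀ {c d} k → c ⊞ k ≡ d ⊞ k → c ≡ d
  ⊞-cancelʳ {c} {d} k e = begin
    c                        ≡⟨ shift c ⟨
    c ⊞ k ⊞ (k * m ∸ k)      ≡⟨ cong (_⊞ (k * m ∸ k)) e ⟩
    d ⊞ k ⊞ (k * m ∸ k)      ≡⟨ shift d ⟩
    d                        ∎
    where
      open ≡-Reasoning
      shift : ∀ c → c ⊞ k ⊞ (k * m ∸ k) ≡ c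
      shift c = begin
        c ⊞ k ⊞ (k * m ∸ k)  ≡⟨ ⊞-assoc c k _ ⟩
        c ⊞ (k + (k * m ∸ k)) ≡⟨ cong (c ⊞_) (m+[n∸m]≡n (m≤m*n k m)) ⟩
        c ⊞ (k * m)          ≡⟨ ⊞-periodic c 0 k ⟩
        c ⊞ 0                ≡⟨ ⊞-identityʳ c ⟩
        c                    ∎

  ⊞-comm : ∀ c d → c ⊞ toℕ d ≡ d ⊞ toℕ c
  ⊞-comm c d = ⊞-≡ c (toℕ d) d (toℕ c) (cong (_% m) (+-comm (toℕ c) (toℕ d)))

  ⊞-swap : ∀ c j k → c ⊞ j ⊞ k ≡ c ⊞ k ⊞ j
  ⊞-swap c j k = begin
    c ⊞ j ⊞ k    ≡⟨ ⊞-assoc c j k ⟩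
    c ⊞ (j + k)  ≡⟨ cong (c ⊞_) (+-comm j k) ⟩
    c ⊞ (k + j)  ≡⟨ ⊞-assoc c k j ⟨
    c ⊞ k ⊞ j    ∎
    where open ≡-Reasoning

  ⊞-toℕ-⊞ : ∀ d c k → d ⊞ toℕ (c ⊞ k) ≡ d ⊞ toℕ c ⊞ k
  ⊞-toℕ-⊞ d c k = begin
    d ⊞ toℕ (c ⊞ k)  ≡⟨ ⊞-comm d (c ⊞ k) ⟩
    c ⊞ k ⊞ toℕ d    ≡⟨ ⊞-swap c k (toℕ d) ⟩
    c ⊞ toℕ d ⊞ k    ≡⟨ cong (_⊞ k) (⊞-comm c d) ⟩
    d ⊞ toℕ c ⊞ k    ∎
    where open ≡-Reasoning

  ⊞-cancelˡ : ∀ c {j k} → j < m → k < m → c ⊞ j ≡ c ⊞ k → j ≡ k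
  ⊞-cancelˡ c {j} {k} j<m k<m e = begin
    j                 ≡⟨ m<n⇒m%n≡m j<m ⟨
    j % m             ≡⟨ toℕ-letter0⊞ j ⟨
    toℕ (letter0 m ⊞ j) ≡⟨ cong toℕ (⊞-cancelʳ (toℕ c) (trans (swap j) (trans e (sym (swap k))))) ⟩
    toℕ (letter0 m ⊞ k) ≡⟨ toℕ-letter0⊞ k ⟩
    k % m             ≡⟨ m<n⇒m%n≡m k<m ⟩
    k                 ∎
    where
      open ≡-Reasoning
      swap : ∀ i → letter0 m ⊞ i ⊞ toℕ c ≡ c ⊞ i
      swap i = begin
        letter0 m ⊞ i ⊞ toℕ c  ≡⟨ ⊞-assoc (letter0 m) i (toℕ c) ⟩
        letter0 m ⊞ (i + toℕ c) ≡⟨ cong (letter0 m ⊞_) (+-comm i (toℕ c)) ⟩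
        letter0 m ⊞ (toℕ c + i) ≡⟨ ⊞-assoc (letter0 m) (toℕ c) i ⟨
        letter0 m ⊞ toℕ c ⊞ i  ≡⟨ cong (_⊞ i) (letter0-⊞ c) ⟩
        c ⊞ i                  ∎

  neg : Fin m → Fin m
  neg c = letter0 m ⊞ (m ∸ toℕ c)

  neg-inverse : ∀ c → neg c ⊞ toℕ c ≡ letter0 m
  neg-inverse c = begin
    letter0 m ⊞ (m ∸ toℕ c) ⊞ toℕ c  ≡⟨ ⊞-assoc (letter0 m) (m ∸ toℕ c) (toℕ c) ⟩
    letter0 m ⊞ (m ∸ toℕ c + toℕ c)  ≡⟨ cong (letter0 m ⊞_) (m∸n+n≡m (<⇒≤ (toℕ<n c))) ⟩
    letter0 m ⊞ m                    ≡⟨ ⊞-m (letter0 m) ⟩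
    letter0 m                        ∎
    where open ≡-Reasoning

  neg-unique : ∀ {d} c → d ⊞ toℕ c ≡ letter0 m → d ≡ neg c
  neg-unique c e = ⊞-cancelʳ (toℕ c) (trans e (sym (neg-inverse c)))

  neg-involutive : ∀ c → neg (neg c) ≡ c
  neg-involutive c = sym (neg-unique (neg c) (trans (⊞-comm c (neg c)) (neg-inverse c)))

  neg-⊞ : ∀ c k → neg (c ⊞ k) ⊞ k ≡ neg c
  neg-⊞ c k = neg-unique c (begin
    neg (c ⊞ k) ⊞ k ⊞ toℕ c  ≡⟨ ⊞-swap (neg (c ⊞ k)) k (toℕ c) ⟩
    neg (c ⊞ k) ⊞ toℕ c ⊞ k  ≡⟨ ⊞-toℕ-⊞ (neg (c ⊞ k)) c k ⟨
    neg (c ⊞ k) ⊞ toℕ (c ⊞ k) ≡⟨ neg-inverse (c ⊞ k) ⟩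
    letter0 m                 ∎)
    where open ≡-Reasoning

  offset : Fin m → Fin m → ℕ
  offset b c = toℕ (neg b ⊞ toℕ c)

  offset<m : ∀ b c → offset b c < m
  offset<m b c = toℕ<n _

  ⊞-offset : ∀ b c → b ⊞ offset b c ≡ c
  ⊞-offset b c = begin
    b ⊞ toℕ (neg b ⊞ toℕ c)  ≡⟨ ⊞-toℕ-⊞ b (neg b) (toℕ c) ⟩
    b ⊞ toℕ (neg b) ⊞ toℕ c  ≡⟨ cong (_⊞ toℕ c) (trans (⊞-comm b (neg b)) (neg-inverse b)) ⟩
    letter0 m ⊞ toℕ c        ≡⟨ letter0-⊞ c ⟩
    c                        ∎
    where open ≡-Reasoning

  -- Runs of consecutive letters and their Parikh vectors

  run : Fin m → ℕ → List (Fin m)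
  run c n = applyUpTo (c ⊞_) n

  length-run : ∀ c n → length (run c n) ≡ n
  length-run c n = length-applyUpTo (c ⊞_) n

  run-cong : ∀ {c d} n → c ≡ d → run c n ≡ run d n
  run-cong n refl = refl

  run-+ : ∀ c j k → run c (j + k) ≡ run c j ++ run (c ⊞ j) k
  run-+ c j k = trans (applyUpTo-+ (c ⊞_) j k) (cong (run c j ++_) (applyUpTo-cong k (λ i _ → sym (⊞-assoc c j i))))

  run-∷ʳ : ∀ c n → run c (suc n) ≡ run c n ∷ʳ (c ⊞ n)
  run-∷ʳ c n = sym (applyUpTo-∷ʳ (c ⊞_) n)

  run-∷ : ∀ c n → run c (suc n) ≡ c ∷ run (c ⊞ 1) n
  run-∷ c n = cong₂ _∷_ (⊞-identityʳ c) (applyUpTo-cong n (λ k _ → sym (⊞-assoc c 1 k)))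

  run-++ : ∀ c j k {d} → c ⊞ j ≡ d → run c j ++ run d k ≡ run c (j + k)
  run-++ c j k refl = sym (run-+ c j k)

  revneg : List (Fin m) → List (Fin m)
  revneg w = reverse (map neg w)

  revneg-++ : ∀ xs ys → revneg (xs ++ ys) ≡ revneg ys ++ revneg xs
  revneg-++ xs ys = trans (cong reverse (map-++ neg xs ys)) (reverse-++ (map neg xs) (map neg ys))

  revneg-run : ∀ c p → revneg (run c (suc p)) ≡ run (neg (c ⊞ p)) (suc p)
  revneg-run c zero    = cong (_∷ []) (sym (⊞-identityʳ (neg (c ⊞ 0))))
  revneg-run c (suc p) = begin
    revneg (run c (suc (suc p)))                    ≡⟨ cong revneg (run-∷ʳ c (suc p)) ⟩
    revneg (run c (suc p) ∷ʳ (c ⊞ suc p))           ≡⟨ revneg-++ (run c (suc p)) _ ⟩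
    neg (c ⊞ suc p) ∷ revneg (run c (suc p))        ≡⟨ cong (neg (c ⊞ suc p) ∷_) (trans (revneg-run c p) (run-cong (suc p) (sym next))) ⟩
    neg (c ⊞ suc p) ∷ run (neg (c ⊞ suc p) ⊞ 1) (suc p) ≡⟨ run-∷ (neg (c ⊞ suc p)) (suc p) ⟨
    run (neg (c ⊞ suc p)) (suc (suc p))             ∎
    where
      open ≡-Reasoning
      next : neg (c ⊞ suc p) ⊞ 1 ≡ neg (c ⊞ p)
      next = trans (cong (λ k → neg (c ⊞ k) ⊞ 1) (+-comm 1 p))
                   (trans (cong (λ d → neg d ⊞ 1) (sym (⊞-assoc c p 1))) (neg-⊞ (c ⊞ p) 1))

  count : Fin m → List (Fin m) → ℕ
  count c w = length (filter (c Fin.≟_) w)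

  count-++ : ∀ c xs ys → count c (xs ++ ys) ≡ count c xs + count c ys
  count-++ c xs ys = trans (cong length (filter-++ (c Fin.≟_) xs ys)) (length-++ (filter (c Fin.≟_) xs))

  count-∉ : ∀ {c} w → c ∉ w → count c w ≡ 0
  count-∉         []      c∉w = refl
  count-∉ {c} (x ∷ w) c∉w with c Fin.≟ x
  ... | yes c≡x = contradiction (here c≡x) c∉w
  ... | no  _   = count-∉ w (c∉w ∘ there)

  count-unique-∈ : ∀ {c w} → Unique w → c ∈ w → count c w ≡ 1
  count-unique-∈ {c} {x ∷ w} u@(_ ∷ _) (here refl) with c Fin.≟ c
  ... | yes _  = cong suc (count-∉ w (Unique[x∷xs]⇒x∉xs u))
  ... | no c≢c = contradiction refl c≢c
  count-unique-∈ {c} {x ∷ w} u@(_ ∷ uw) (there c∈w) with c Fin.≟ x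
  ... | yes refl = contradiction c∈w (Unique[x∷xs]⇒x∉xs u)
  ... | no  _    = count-unique-∈ uw c∈w

  count-unique-≤1 : ∀ c {w} → Unique w → count c w ≤ 1
  count-unique-≤1 c {w} u with c ∈? w
  ... | yes c∈w = ≤-reflexive (count-unique-∈ u c∈w)
  ... | no  c∉w = subst (_≤ 1) (sym (count-∉ w c∉w)) z≤n

  lookup-Ψ : ∀ w c → lookup (Ψ m w) c ≡ count c w
  lookup-Ψ w c = lookup∘tabulate (λ a → count a w) c

  Ψ≡⇒count≡ : ∀ {w w′} → Ψ m w ≡ Ψ m w′ → ∀ c → count c w ≡ count c w′
  Ψ≡⇒count≡ {w} {w′} Ψ≡ c = trans (sym (lookup-Ψ w c)) (trans (cong (λ v → lookup v c) Ψ≡) (lookup-Ψ w′ c))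

  Ψ-↭ : ∀ {xs ys} → xs ↭ ys → Ψ m xs ≡ Ψ m ys
  Ψ-↭ xs↭ys = tabulate-cong (λ c → ↭-length (filter-↭ (c Fin.≟_) xs↭ys))

  count-map-neg : ∀ c w → count c (map neg w) ≡ count (neg c) w
  count-map-neg c []      = refl
  count-map-neg c (x ∷ w) with c Fin.≟ neg x | neg c Fin.≟ x
  ... | yes _    | yes _    = cong suc (count-map-neg c w)
  ... | no  _    | no  _    = count-map-neg c w
  ... | yes c≡   | no  ≢x   = contradiction (trans (cong neg c≡) (neg-involutive x)) ≢x
  ... | no  c≢   | yes ≡x   = contradiction (trans (sym (neg-involutive c)) (cong neg ≡x)) c≢

  count-revneg : ∀ c w → count c (revneg w) ≡ count (neg c) w
  count-revneg c w = trans (↭-length (filter-↭ (c Fin.≟_) (↭-reverse (map neg w)))) (count-map-neg c w)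

  negv : Vec ℕ m → Vec ℕ m
  negv v = tabulate (λ c → lookup v (neg c))

  Ψ-revneg : ∀ w → Ψ m (revneg w) ≡ negv (Ψ m w)
  Ψ-revneg w = tabulate-cong (λ c → trans (count-revneg c w) (sym (lookup-Ψ w (neg c))))

  negv-involutive : ∀ v → negv (negv v) ≡ v
  negv-involutive v = trans (tabulate-cong (λ c → trans (lookup∘tabulate _ (neg c)) (cong (lookup v) (neg-involutive c))))
                            (tabulate∘lookup v)

  run-unique : ∀ c {p} → p ≤ m → Unique (run c p)
  run-unique c p≤m = Unique.applyUpTo⁺₁ (c ⊞_) _
    (λ i<j j<p e → <⇒≢ i<j (⊞-cancelˡ c (<-trans i<j (<-≤-trans j<p p≤m)) (<-≤-trans j<p p≤m) e))

  ⊞-window-injective : ∀ c {i j} → i ≤ j → j < i + m → c ⊞ i ≡ c ⊞ j → i ≡ j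
  ⊞-window-injective c {i} {j} i≤j j<i+m e = begin
    i              ≡⟨ +-identityʳ i ⟨
    i + 0          ≡⟨ cong (i +_) (⊞-cancelˡ (c ⊞ i) 0<m j∸i<m shifted) ⟩
    i + (j ∸ i)    ≡⟨ m+[n∸m]≡n i≤j ⟩
    j              ∎
    where
      open ≡-Reasoning
      j∸i<m : j ∸ i < m
      j∸i<m = subst (j ∸ i <_) (m+n∸m≡n i m) (∸-monoˡ-< j<i+m i≤j)
      shifted : c ⊞ i ⊞ 0 ≡ c ⊞ i ⊞ (j ∸ i)
      shifted = trans (⊞-identityʳ (c ⊞ i)) (trans e (sym (trans (⊞-assoc c i (j ∸ i)) (cong (c ⊞_) (m+[n∸m]≡n i≤j)))))

  count-run-inside : ∀ a {x p r} → p ≤ m → x ≤ r → r < x + p → count (a ⊞ r) (run (a ⊞ x) p) ≡ 1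
  count-run-inside a {x} {p} {r} p≤m x≤r r<x+p = count-unique-∈ (run-unique (a ⊞ x) p≤m)
    (subst (_∈ run (a ⊞ x) p) a⊞x⊞[r∸x]≡a⊞r (∈-applyUpTo⁺ (a ⊞ x ⊞_) r∸x<p))
    where
      r∸x<p : r ∸ x < p
      r∸x<p = subst (r ∸ x <_) (m+n∸m≡n x p) (∸-monoˡ-< r<x+p x≤r)
      a⊞x⊞[r∸x]≡a⊞r : a ⊞ x ⊞ (r ∸ x) ≡ a ⊞ r
      a⊞x⊞[r∸x]≡a⊞r = trans (⊞-assoc a x (r ∸ x)) (cong (a ⊞_) (m+[n∸m]≡n x≤r))

  count-run-outside : ∀ a {x p r} → x + p ≤ r → r < x + m → count (a ⊞ r) (run (a ⊞ x) p) ≡ 0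
  count-run-outside a {x} {p} {r} x+p≤r r<x+m = count-∉ (run (a ⊞ x) p) a⊞r∉
    where
      a⊞r∉ : a ⊞ r ∉ run (a ⊞ x) p
      a⊞r∉ a⊞r∈ with ∈-applyUpTo⁻ (a ⊞ x ⊞_) a⊞r∈
      ... | k , k<p , a⊞r≡ = <⇒≢ x+k<r (⊞-window-injective a (<⇒≤ x+k<r) r<x+k+m (trans (sym (⊞-assoc a x k)) (sym a⊞r≡)))
        where
          x+k<r : x + k < r
          x+k<r = <-≤-trans (+-monoʳ-< x k<p) x+p≤r
          r<x+k+m : r < x + k + m
          r<x+k+m = <-≤-trans r<x+m (+-monoˡ-≤ m (m≤m+n x k))

  count-run-≤1 : ∀ c e {p} → p ≤ m → count e (run c p) ≤ 1
  count-run-≤1 c e p≤m = count-unique-≤1 e (run-unique c p≤m)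

  -- The fixed point t_m and its factors

  σ≡run : ∀ c → σ m c ≡ run c m
  σ≡run c = map-upTo (c ⊞_) m

  nth-++ˡ : ∀ xs ys {k} → k < length xs → nth m (xs ++ ys) k ≡ nth m xs k
  nth-++ˡ (x ∷ xs) ys {zero}  _         = refl
  nth-++ˡ (x ∷ xs) ys {suc k} (s≤s k<n) = nth-++ˡ xs ys k<n

  nth-++ʳ : ∀ xs ys k → nth m (xs ++ ys) (length xs + k) ≡ nth m ys k
  nth-++ʳ []       ys k = refl
  nth-++ʳ (x ∷ xs) ys k = nth-++ʳ xs ys k

  nth-applyUpTo : ∀ (f : ℕ → Fin m) {n k} → k < n → nth m (applyUpTo f n) k ≡ f k
  nth-applyUpTo f {suc n} {zero}  _         = refl
  nth-applyUpTo f {suc n} {suc k} (s≤s k<n) = nth-applyUpTo (f ∘ suc) k<n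

  length-σ : ∀ c → length (σ m c) ≡ m
  length-σ c = trans (cong length (σ≡run c)) (length-run c m)

  length-σ* : ∀ w → length (σ* m w) ≡ m * length w
  length-σ* []      = sym (*-zeroʳ m)
  length-σ* (x ∷ w) = begin
    length (σ m x ++ σ* m w)         ≡⟨ length-++ (σ m x) ⟩
    length (σ m x) + length (σ* m w) ≡⟨ cong₂ _+_ (length-σ x) (length-σ* w) ⟩
    m + m * length w                 ≡⟨ *-suc m (length w) ⟨
    m * suc (length w)               ∎
    where open ≡-Reasoning

  length-σpow : ∀ j → length (σpow m j) ≡ m ^ j
  length-σpow zero    = refl
  length-σpow (suc j) = trans (length-σ* (σpow m j)) (cong (m *_) (length-σpow j))

  nth-σ* : ∀ w {k r} → k < length w → r < m → nth m (σ* m w) (m * k + r) ≡ nth m w k ⊞ r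
  nth-σ* (x ∷ w) {zero} {r} _ r<m = begin
    nth m (σ m x ++ σ* m w) (m * 0 + r) ≡⟨ cong (λ i → nth m (σ m x ++ σ* m w) (i + r)) (*-zeroʳ m) ⟩
    nth m (σ m x ++ σ* m w) r           ≡⟨ nth-++ˡ (σ m x) (σ* m w) (subst (r <_) (sym (length-σ x)) r<m) ⟩
    nth m (σ m x) r                     ≡⟨ cong (λ v → nth m v r) (σ≡run x) ⟩
    nth m (run x m) r                   ≡⟨ nth-applyUpTo (x ⊞_) r<m ⟩
    x ⊞ r                               ∎
    where open ≡-Reasoning
  nth-σ* (x ∷ w) {suc k} {r} (s≤s k<n) r<m = begin
    nth m (σ m x ++ σ* m w) (m * suc k + r)                  ≡⟨ cong (nth m (σ m x ++ σ* m w)) index ⟩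
    nth m (σ m x ++ σ* m w) (length (σ m x) + (m * k + r))   ≡⟨ nth-++ʳ (σ m x) (σ* m w) (m * k + r) ⟩
    nth m (σ* m w) (m * k + r)                               ≡⟨ nth-σ* w k<n r<m ⟩
    nth m w k ⊞ r                                            ∎
    where
      open ≡-Reasoning
      index : m * suc k + r ≡ length (σ m x) + (m * k + r)
      index = begin
        m * suc k + r        ≡⟨ cong (_+ r) (*-suc m k) ⟩
        m + m * k + r        ≡⟨ +-assoc m (m * k) r ⟩
        m + (m * k + r)      ≡⟨ cong (_+ (m * k + r)) (length-σ x) ⟨
        length (σ m x) + (m * k + r) ∎

  σpow-extends : ∀ j → ∃ λ rest → σpow m j ++ rest ≡ σpow m (suc j)
  σpow-extends zero = run (letter0 m ⊞ 1) (pred m) ++ [] , sym (begin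
    σ m (letter0 m) ++ []                              ≡⟨ cong (_++ []) (σ≡run (letter0 m)) ⟩
    run (letter0 m) m ++ []                            ≡⟨ cong (λ n → run (letter0 m) n ++ []) (suc-pred m) ⟨
    run (letter0 m) (suc (pred m)) ++ []               ≡⟨ cong (_++ []) (run-∷ (letter0 m) (pred m)) ⟩
    letter0 m ∷ run (letter0 m ⊞ 1) (pred m) ++ []     ∎)
    where open ≡-Reasoning
  σpow-extends (suc j) with σpow-extends j
  ... | rest , extends = σ* m rest , trans (sym (concatMap-++ (σ m) (σpow m j) rest)) (cong (σ* m) extends)

  nth-σpow-suc : ∀ j {n} → n < m ^ j → nth m (σpow m j) n ≡ nth m (σpow m (suc j)) n
  nth-σpow-suc j {n} n< with σpow-extends j
  ... | rest , extends = trans (sym (nth-++ˡ (σpow m j) rest (subst (n <_) (sym (length-σpow j)) n<)))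
                               (cong (λ w → nth m w n) extends)

  nth-σpow-+ : ∀ d j {n} → n < m ^ j → nth m (σpow m j) n ≡ nth m (σpow m (d + j)) n
  nth-σpow-+ zero    j n< = refl
  nth-σpow-+ (suc d) j n< =
    trans (nth-σpow-+ d j n<) (nth-σpow-suc (d + j) (<-≤-trans n< (^-monoʳ-≤ m (m≤n+m j d))))

  data TwoRuns (n : ℕ) : List (Fin m) → Set where
    twoRuns : ∀ c p d q → 1 ≤ p → p + q ≡ n → TwoRuns n (run c p ++ run d q)

  TwoRuns-revneg : ∀ {n w} → TwoRuns n w → TwoRuns n (revneg w)
  TwoRuns-revneg (twoRuns c (suc p) d zero _ p+0≡n) =
    subst (TwoRuns _) (trans (++-identityʳ _) (sym (trans (revneg-++ (run c (suc p)) []) (revneg-run c p))))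
          (twoRuns (neg (c ⊞ p)) (suc p) d 0 (s≤s z≤n) p+0≡n)
  TwoRuns-revneg (twoRuns c (suc p) d (suc q) _ p+q≡n) =
    subst (TwoRuns _) (sym (trans (revneg-++ (run c (suc p)) (run d (suc q))) (cong₂ _++_ (revneg-run d q) (revneg-run c p))))
          (twoRuns (neg (d ⊞ q)) (suc q) (neg (c ⊞ p)) (suc p) (s≤s z≤n) (trans (+-comm (suc q) (suc p)) p+q≡n))

  module _ (1<m : 1 < m) where

    m*q+m≡m*[1+q]+0 : ∀ q → m * q + m ≡ m * suc q + 0
    m*q+m≡m*[1+q]+0 q = trans (+-comm (m * q) m) (trans (sym (*-suc m q)) (sym (+-identityʳ (m * suc q))))

    n<m^[1+n] : ∀ n → n < m ^ suc n
    n<m^[1+n] zero    = m^n>0 m 1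
    n<m^[1+n] (suc n) = ≤-<-trans (n<m^[1+n] n) (^-monoʳ-< m 1<m (n<1+n (suc n)))

    t-σpow : ∀ j {n} → n < m ^ j → t m n ≡ nth m (σpow m j) n
    t-σpow j {n} n< = begin
      nth m (σpow m (suc n)) n      ≡⟨ nth-σpow-+ j (suc n) (n<m^[1+n] n) ⟩
      nth m (σpow m (j + suc n)) n  ≡⟨ cong (λ i → nth m (σpow m i) n) (+-comm j (suc n)) ⟩
      nth m (σpow m (suc n + j)) n  ≡⟨ nth-σpow-+ (suc n) j n< ⟨
      nth m (σpow m j) n            ∎
      where open ≡-Reasoning

    t-digit : ∀ q {r} → r < m → t m (m * q + r) ≡ t m q ⊞ r
    t-digit q {r} r<m = trans (t-σpow (suc (suc q)) bound) (nth-σ* (σpow m (suc q)) q<length r<m)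
      where
        q<length : q < length (σpow m (suc q))
        q<length = subst (q <_) (sym (length-σpow (suc q))) (n<m^[1+n] q)
        bound : m * q + r < m ^ suc (suc q)
        bound = begin-strict
          m * q + r      <⟨ +-monoʳ-< (m * q) r<m ⟩
          m * q + m      ≡⟨ +-comm (m * q) m ⟩
          m + m * q      ≡⟨ *-suc m q ⟨
          m * suc q      ≤⟨ *-monoʳ-≤ m (n<m^[1+n] q) ⟩
          m * m ^ suc q  ∎
          where open ≤-Reasoning

    t-toℕ : ∀ c → t m (toℕ c) ≡ c
    t-toℕ c = begin
      t m (toℕ c)          ≡⟨ cong (λ i → t m (i + toℕ c)) (*-zeroʳ m) ⟨
      t m (m * 0 + toℕ c)  ≡⟨ t-digit 0 (toℕ<n c) ⟩
      t m 0 ⊞ toℕ c        ≡⟨ cong (_⊞ toℕ c) (t-σpow 0 (s≤s z≤n)) ⟩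
      letter0 m ⊞ toℕ c    ≡⟨ letter0-⊞ c ⟩
      c                    ∎
      where open ≡-Reasoning

    Adjacent : Fin m → Fin m → Set
    Adjacent b c = ∃ λ i → t m i ≡ b × t m (suc i) ≡ c

    adjacent-⊞1 : ∀ c → Adjacent c (c ⊞ 1)
    adjacent-⊞1 c = m * toℕ c , first , second
      where
        at : ∀ {r} → r < m → t m (m * toℕ c + r) ≡ c ⊞ r
        at r<m = trans (t-digit (toℕ c) r<m) (cong (_⊞ _) (t-toℕ c))
        first : t m (m * toℕ c) ≡ c
        first = trans (cong (t m) (sym (+-identityʳ (m * toℕ c)))) (trans (at 0<m) (⊞-identityʳ c))
        second : t m (suc (m * toℕ c)) ≡ c ⊞ 1
        second = trans (cong (t m) (+-comm 1 (m * toℕ c))) (at 1<m)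

    -- The block σ_m(t_m(i)) ends with t_m(i) − 1 and the next one starts with t_m(i + 1).
    adjacent-pred : ∀ {b c} → Adjacent (b ⊞ 1) c → Adjacent b c
    adjacent-pred {b} {c} (i , ti≡b⊞1 , t[1+i]≡c) = m * i + (m ∸ 1) , first , second
      where
        first : t m (m * i + (m ∸ 1)) ≡ b
        first = begin
          t m (m * i + (m ∸ 1))  ≡⟨ t-digit i (∸-monoʳ-< z<s 0<m) ⟩  
          t m i ⊞ (m ∸ 1)        ≡⟨ cong (_⊞ (m ∸ 1)) ti≡b⊞1 ⟩
          b ⊞ 1 ⊞ (m ∸ 1)        ≡⟨ ⊞-∸-m b 1 0<m ⟩
          b                      ∎
          where open ≡-Reasoning
        second : t m (suc (m * i + (m ∸ 1))) ≡ c
        second = begin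
          t m (suc (m * i + (m ∸ 1)))  ≡⟨ cong (t m) index ⟩
          t m (m * suc i + 0)          ≡⟨ t-digit (suc i) 0<m ⟩
          t m (suc i) ⊞ 0              ≡⟨ ⊞-identityʳ (t m (suc i)) ⟩
          t m (suc i)                  ≡⟨ t[1+i]≡c ⟩
          c                            ∎
          where
            open ≡-Reasoning
            index : suc (m * i + (m ∸ 1)) ≡ m * suc i + 0
            index = trans (sym (+-suc (m * i) (m ∸ 1))) (trans (cong (m * i +_) (m+[n∸m]≡n 0<m)) (m*q+m≡m*[1+q]+0 i))

    adjacent-⊞ : ∀ {b c} k → Adjacent (b ⊞ k) c → Adjacent b c
    adjacent-⊞ {b} zero    adj = subst (λ a → Adjacent a _) (⊞-identityʳ b) adj
    adjacent-⊞ {b} (suc k) adj = adjacent-pred (adjacent-⊞ k (subst (λ a → Adjacent a _) (sym (⊞-assoc b 1 k)) adj))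

    all-adjacent : ∀ b c → Adjacent b c
    all-adjacent b c = adjacent-⊞ (offset b c′) (subst (λ a → Adjacent a c) (sym (⊞-offset b c′)) c′-adjacent)
      where
        c′ = c ⊞ (m ∸ 1)
        c′⊞1≡c : c′ ⊞ 1 ≡ c
        c′⊞1≡c = ⊞-m∸ c 1 0<m
        c′-adjacent : Adjacent c′ c
        c′-adjacent = subst (Adjacent c′) c′⊞1≡c (adjacent-⊞1 c′)

    factorAt-++ : ∀ i j k → factorAt m i (j + k) ≡ factorAt m i j ++ factorAt m (i + j) k
    factorAt-++ i j k = begin
      factorAt m i (j + k)                                              ≡⟨ map-upTo _ (j + k) ⟩
      applyUpTo (λ n → t m (i + n)) (j + k)                             ≡⟨ applyUpTo-+ _ j k ⟩
      applyUpTo (λ n → t m (i + n)) j ++ applyUpTo (λ n → t m (i + (j + n))) k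
        ≡⟨ cong₂ _++_ (sym (map-upTo _ j)) (trans (applyUpTo-cong k (λ n _ → cong (t m) (sym (+-assoc i j n)))) (sym (map-upTo _ k))) ⟩
      factorAt m i j ++ factorAt m (i + j) k                            ∎
      where open ≡-Reasoning

    factorAt-run : ∀ q {r n} → r + n ≤ m → factorAt m (m * q + r) n ≡ run (t m q ⊞ r) n
    factorAt-run q {r} {n} r+n≤m = trans (map-upTo _ n) (applyUpTo-cong n letter)
      where
        letter : ∀ k → k < n → t m (m * q + r + k) ≡ t m q ⊞ r ⊞ k
        letter k k<n = begin
          t m (m * q + r + k)    ≡⟨ cong (t m) (+-assoc (m * q) r k) ⟩
          t m (m * q + (r + k))  ≡⟨ t-digit q (<-≤-trans (+-monoʳ-< r k<n) r+n≤m) ⟩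
          t m q ⊞ (r + k)        ≡⟨ ⊞-assoc (t m q) r k ⟨
          t m q ⊞ r ⊞ k          ∎
          where open ≡-Reasoning

    factorAt-two-runs : ∀ q {p n} → p ≤ m → n ≤ m →
      factorAt m (m * q + (m ∸ p)) (p + n) ≡ run (t m q ⊞ (m ∸ p)) p ++ run (t m (suc q)) n
    factorAt-two-runs q {p} {n} p≤m n≤m = begin
      factorAt m (m * q + (m ∸ p)) (p + n)
        ≡⟨ factorAt-++ (m * q + (m ∸ p)) p n ⟩
      factorAt m (m * q + (m ∸ p)) p ++ factorAt m (m * q + (m ∸ p) + p) n
        ≡⟨ cong₂ _++_ (factorAt-run q (≤-reflexive (m∸n+n≡m p≤m))) (cong (λ i → factorAt m i n) index) ⟩
      run (t m q ⊞ (m ∸ p)) p ++ factorAt m (m * suc q + 0) n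
        ≡⟨ cong (run _ p ++_) (trans (factorAt-run (suc q) n≤m) (run-cong n (⊞-identityʳ _))) ⟩
      run (t m q ⊞ (m ∸ p)) p ++ run (t m (suc q)) n ∎
      where
        open ≡-Reasoning
        index : m * q + (m ∸ p) + p ≡ m * suc q + 0
        index = trans (+-assoc (m * q) (m ∸ p) p) (trans (cong (m * q +_) (m∸n+n≡m p≤m)) (m*q+m≡m*[1+q]+0 q))

    factor-twoRuns : ∀ {l} → l < m → ∀ i → TwoRuns (suc l) (factorAt m i (suc l))
    factor-twoRuns {l} l<m i with i % m + suc l ≤? m
    ... | yes fits = subst (TwoRuns _) (sym (begin
          factorAt m i (suc l)                    ≡⟨ cong (λ j → factorAt m j (suc l)) i≡ ⟩
          factorAt m (m * q + r) (suc l)          ≡⟨ factorAt-run q fits ⟩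
          run (t m q ⊞ r) (suc l)                 ≡⟨ ++-identityʳ _ ⟨
          run (t m q ⊞ r) (suc l) ++ run c 0      ∎))
        (twoRuns (t m q ⊞ r) (suc l) c 0 (s≤s z≤n) (+-identityʳ (suc l)))
      where
        open ≡-Reasoning
        q = i / m
        r = i % m
        c = t m q
        i≡ : i ≡ m * q + r
        i≡ = trans (m≡m%n+[m/n]*n i m) (trans (+-comm r (q * m)) (cong (_+ r) (*-comm q m)))
    ... | no overflows = subst (TwoRuns _) (sym (begin
          factorAt m i (suc l)                                 ≡⟨ cong₂ (factorAt m) i≡ (sym p+q≡) ⟩
          factorAt m (m * d + (m ∸ p)) (p + q)                 ≡⟨ factorAt-two-runs d (m∸n≤m m r) q≤m ⟩
          run (t m d ⊞ (m ∸ p)) p ++ run (t m (suc d)) q       ∎))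
        (twoRuns (t m d ⊞ (m ∸ p)) p (t m (suc d)) q (m<n⇒0<n∸m r<m) p+q≡)
      where
        open ≡-Reasoning
        d = i / m
        r = i % m
        p = m ∸ r
        q = suc l ∸ p
        r<m : r < m
        r<m = m%n<n i m
        i≡ : i ≡ m * d + (m ∸ p)
        i≡ = trans (m≡m%n+[m/n]*n i m) (trans (+-comm r (d * m)) (cong₂ _+_ (*-comm d m) (sym (m∸[m∸n]≡n (<⇒≤ r<m)))))
        p≤1+l : p ≤ suc l
        p≤1+l = subst (p ≤_) (m+n∸m≡n r (suc l)) (∸-monoˡ-≤ r (<⇒≤ (≰⇒> overflows)))
        p+q≡ : p + q ≡ suc l
        p+q≡ = m+[n∸m]≡n p≤1+l
        q≤m : q ≤ m
        q≤m = ≤-trans (m∸n≤m (suc l) p) l<m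

    twoRuns-factor : ∀ {n w} → n ≤ m → TwoRuns n w → ∃ λ i → factorAt m i n ≡ w
    twoRuns-factor {n} n≤m (twoRuns c p d q _ p+q≡n) with all-adjacent (c ⊞ p) d
    ... | k , tk≡c⊞p , t[1+k]≡d = m * k + (m ∸ p) , (begin
          factorAt m (m * k + (m ∸ p)) n                     ≡⟨ cong (factorAt m (m * k + (m ∸ p))) (sym p+q≡n) ⟩
          factorAt m (m * k + (m ∸ p)) (p + q)               ≡⟨ factorAt-two-runs k p≤m q≤m ⟩
          run (t m k ⊞ (m ∸ p)) p ++ run (t m (suc k)) q     ≡⟨ cong₂ _++_ (run-cong p first) (run-cong q t[1+k]≡d) ⟩
          run c p ++ run d q                                 ∎)
      where
        open ≡-Reasoning
        p≤m : p ≤ m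
        p≤m = ≤-trans (m≤m+n p q) (subst (_≤ m) (sym p+q≡n) n≤m)
        q≤m : q ≤ m
        q≤m = ≤-trans (m≤n+m q p) (subst (_≤ m) (sym p+q≡n) n≤m)
        first : t m k ⊞ (m ∸ p) ≡ c
        first = trans (cong (_⊞ (m ∸ p)) tk≡c⊞p) (⊞-∸-m c p p≤m)

    factor-revneg : ∀ {l w} → l < m → (∃ λ i → factorAt m i (suc l) ≡ w) → ∃ λ i → factorAt m i (suc l) ≡ revneg w
    factor-revneg l<m (i , refl) = twoRuns-factor l<m (TwoRuns-revneg (factor-twoRuns l<m i))

  -- Canonical forms

  module _ (ℓ : ℕ) (1≤ℓ : 1 ≤ ℓ) (ℓ<m : ℓ < m) where

    canonicalWord : Fin m → ℕ × ℕ → List (Fin m)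
    canonicalWord a (q , x) = run (a ⊞ x) (ℓ ∸ q) ++ run (a ⊞ (m ∸ q)) q

    -- The second run of canonicalWord a (q , x) consists of the q letters just before a.
    -- Canonical picks one pair per Parikh vector: 1 ≤ x and x + ℓ ≢ m rule out the two ways the
    -- runs can join into one, and x + q ≤ m rules out a first run starting inside the second.
    data Canonical : ℕ × ℕ → Set where
      single : ∀ {x} → x < m → Canonical (0 , x)
      split  : ∀ {q x} → 1 ≤ q → q < ℓ → 1 ≤ x → x + q ≤ m → x + ℓ ≢ m → Canonical (q , x)

    canonical-q<ℓ : ∀ {q x} → Canonical (q , x) → q < ℓ
    canonical-q<ℓ (single _)          = 1≤ℓ
    canonical-q<ℓ (split _ q<ℓ _ _ _) = q<ℓ

    canonical-x+q≤m : ∀ {q x} → Canonical (q , x) → x + q ≤ m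
    canonical-x+q≤m {x = x} (single x<m)        = subst (_≤ m) (sym (+-identityʳ x)) (<⇒≤ x<m)
    canonical-x+q≤m (split _ _ _ x+q≤m _)       = x+q≤m

    canonical-x<m : ∀ {q x} → Canonical (q , x) → x < m
    canonical-x<m (single x<m)             = x<m
    canonical-x<m {q} {x} (split 1≤q _ _ x+q≤m _) = <-≤-trans (subst (_< x + q) (+-identityʳ x) (+-monoʳ-< x 1≤q)) x+q≤m

    SameCounts : Fin m → ℕ × ℕ → ℕ × ℕ → Set
    SameCounts a P P′ = ∀ r → count (a ⊞ r) (canonicalWord a P) ≡ count (a ⊞ r) (canonicalWord a P′)

    -- An offset r stands for the letter a ⊞ r; the first run covers the offsets [x, x + p),
    -- the second one [s, m).
    module Profile (a : Fin m) {q x : ℕ} (can : Canonical (q , x)) where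

      p s : ℕ
      p = ℓ ∸ q
      s = m ∸ q

      q<ℓ : q < ℓ
      q<ℓ = canonical-q<ℓ can

      x+q≤m : x + q ≤ m
      x+q≤m = canonical-x+q≤m can

      q≤m : q ≤ m
      q≤m = ≤-trans (<⇒≤ q<ℓ) (<⇒≤ ℓ<m)

      p<m : p < m
      p<m = ≤-<-trans (m∸n≤m ℓ q) ℓ<m

      1≤p : 1 ≤ p
      1≤p = m<n⇒0<n∸m q<ℓ

      x≤s : x ≤ s
      x≤s = subst (_≤ s) (m+n∸n≡m x q) (∸-monoˡ-≤ q x+q≤m)

      s+q≡m : s + q ≡ m
      s+q≡m = m∸n+n≡m q≤m

      v : ℕ → ℕ
      v r = count (a ⊞ r) (canonicalWord a (q , x))

      inFirst inSecond : ℕ → ℕ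
      inFirst r = count (a ⊞ r) (run (a ⊞ x) p)
      inSecond r = count (a ⊞ r) (run (a ⊞ s) q)

      v≡ : ∀ r → v r ≡ inFirst r + inSecond r
      v≡ r = count-++ (a ⊞ r) (run (a ⊞ x) p) (run (a ⊞ s) q)

      v-+m : ∀ r → v (r + m) ≡ v r
      v-+m r = cong (λ c → count c (canonicalWord a (q , x))) (⊞-+m a r)

      inFirst-inside : ∀ {r} → x ≤ r → r < x + p → inFirst r ≡ 1
      inFirst-inside = count-run-inside a (<⇒≤ p<m)

      inFirst-outside : ∀ {r} → x + p ≤ r → r < x + m → inFirst r ≡ 0
      inFirst-outside = count-run-outside a

      inFirst-≤1 : ∀ r → inFirst r ≤ 1
      inFirst-≤1 r = count-run-≤1 (a ⊞ x) (a ⊞ r) (<⇒≤ p<m)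

      inSecond-inside : ∀ {r} → s ≤ r → r < m → inSecond r ≡ 1
      inSecond-inside s≤r r<m = count-run-inside a q≤m s≤r (subst (_ <_) (sym s+q≡m) r<m)

      inSecond-outside : ∀ {r} → r < s → inSecond r ≡ 0
      inSecond-outside {r} r<s = trans (cong (λ c → count c (run (a ⊞ s) q)) (sym (⊞-+m a r)))
        (count-run-outside a (subst (_≤ r + m) (sym s+q≡m) (m≤n+m m r)) (+-monoˡ-< m r<s))

      inside : ∀ {r} → x ≤ r → r < x + p → 1 ≤ v r
      inside x≤r r<x+p = subst (1 ≤_) (sym (v≡ _)) (subst (λ k → 1 ≤ k + inSecond _) (sym (inFirst-inside x≤r r<x+p)) (s≤s z≤n))

      gap : ∀ {r} → r < x → x + p ≤ r + m → v r ≡ 0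
      gap {r} r<x x+p≤r+m = trans (v≡ r) (cong₂ _+_
        (trans (cong (λ c → count c (run (a ⊞ x) p)) (sym (⊞-+m a r))) (inFirst-outside x+p≤r+m (+-monoˡ-< m r<x)))
        (inSecond-outside (<-≤-trans r<x x≤s)))

    first-run-wraps : ∀ a {q x q′ x′} (c : Canonical (q , x)) (c′ : Canonical (q′ , x′)) →
                      SameCounts a (q , x) (q′ , x′) → x < x′ → x + m < x′ + Profile.p a c′
    first-run-wraps a {x = x} c c′ same x<x′ = ≰⇒> x′+p′≰x+m
      where
        module A = Profile a c
        module B = Profile a c′
        x′+p′≰x+m : ¬ _ + B.p ≤ x + m
        x′+p′≰x+m x′+p′≤x+m = m<n⇒n≢0 (A.inside ≤-refl (m<m+n x A.1≤p)) (trans (same x) (B.gap x<x′ x′+p′≤x+m))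

    -- By first-run-wraps the letter just before a ⊞ x (a ⊞ (m − 1) if x = 0) lies in the first
    -- run of (q′ , x′), but in neither run of (q , x).
    x-determined : ∀ a {q x q′ x′} (c : Canonical (q , x)) (c′ : Canonical (q′ , x′)) →
                   SameCounts a (q , x) (q′ , x′) → ¬ x < x′
    x-determined a {x = zero} (split _ _ () _ _) _ _ _
    x-determined a {x = zero} {x′ = x′} c@(single _) c′ same x<x′ =
      m<n⇒n≢0 (B.inside x′≤m∸1 m∸1<x′+p′) (trans (sym (same (m ∸ 1))) v[m∸1]≡0)
      where
        module A = Profile a c
        module B = Profile a c′
        x′≤m∸1 : x′ ≤ m ∸ 1
        x′≤m∸1 = <⇒≤pred (canonical-x<m c′)
        m∸1<x′+p′ : m ∸ 1 < x′ + B.p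
        m∸1<x′+p′ = ≤-<-trans (m∸n≤m m 1) (first-run-wraps a c c′ same x<x′)
        v[m∸1]≡0 : A.v (m ∸ 1) ≡ 0
        v[m∸1]≡0 = trans (A.v≡ (m ∸ 1)) (trans (+-identityʳ _) (A.inFirst-outside (<⇒≤pred ℓ<m) (∸-monoʳ-< z<s 0<m)))
    x-determined a {x = suc x₁} {x′ = x′} c c′ same x<x′ =
      m<n⇒n≢0 (subst (1 ≤_) (B.v-+m x₁) (B.inside x′≤x₁+m x₁+m<x′+p′)) (trans (sym (same x₁)) v[x₁]≡0)
      where
        module A = Profile a c
        module B = Profile a c′
        x′≤x₁+m : x′ ≤ x₁ + m
        x′≤x₁+m = ≤-trans (<⇒≤ (canonical-x<m c′)) (m≤n+m m x₁)
        x₁+m<x′+p′ : x₁ + m < x′ + B.p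
        x₁+m<x′+p′ = <-trans (+-monoˡ-< m (n<1+n x₁)) (first-run-wraps a c c′ same x<x′)
        v[x₁]≡0 : A.v x₁ ≡ 0
        v[x₁]≡0 = A.gap (n<1+n x₁) (subst (_≤ x₁ + m) (+-suc x₁ A.p) (+-monoʳ-≤ x₁ A.p<m))

    -- With p′ < p, the offset r = x + p′ just after the shorter first run separates the two words,
    -- unless it lies in the second run of (q′ , x) but not in that of (q , x); then the start s′
    -- of the former is counted twice for (q′ , x) but at most once for (q , x).
    q-determined : ∀ a {q q′ x} (c : Canonical (q , x)) (c′ : Canonical (q′ , x)) →
                   SameCounts a (q , x) (q′ , x) → ¬ q < q′
    q-determined a c (single _) same ()
    q-determined a {q} {q′} {x} c c′@(split 1≤q′ q′<ℓ _ _ x+ℓ≢m) same q<q′ = contradictory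
      where
        module A = Profile a c
        module B = Profile a c′
        2≰1 : ∀ {u} → u ≡ 2 → ¬ u ≤ 1
        2≰1 refl (s≤s ())
        p′<p : B.p < A.p
        p′<p = ∸-monoʳ-< q<q′ (<⇒≤ q′<ℓ)
        s′<s : B.s < A.s
        s′<s = ∸-monoʳ-< q<q′ B.q≤m
        r = x + B.p
        inFirst[r] : A.inFirst r ≡ 1
        inFirst[r] = A.inFirst-inside (m≤m+n x B.p) (+-monoʳ-< x p′<p)
        inFirst′[r] : B.inFirst r ≡ 0
        inFirst′[r] = B.inFirst-outside ≤-refl (+-monoʳ-< x B.p<m)
        s′≢r : B.s ≢ r
        s′≢r s′≡r = x+ℓ≢m (begin
          x + ℓ              ≡⟨ cong (x +_) (m∸n+n≡m (<⇒≤ q′<ℓ)) ⟨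
          x + (B.p + q′)     ≡⟨ +-assoc x B.p q′ ⟨
          r + q′             ≡⟨ cong (_+ q′) s′≡r ⟨
          B.s + q′           ≡⟨ B.s+q≡m ⟩
          m                  ∎)
          where open ≡-Reasoning
        contradictory : ⊥
        contradictory with r <? m
        ... | no r≮m = m<n⇒n≢0 (subst (1 ≤_) (A.v-+m r′) (A.inside x≤r′+m r′+m<x+p))
                                (trans (same r′) (B.gap r′<x (≤-reflexive (sym r′+m≡r))))
          where
            r′ = r ∸ m
            r′+m≡r : r′ + m ≡ r
            r′+m≡r = m∸n+n≡m (≮⇒≥ r≮m)
            r′<x : r′ < x
            r′<x = subst (r′ <_) (m+n∸n≡m x m) (∸-monoˡ-< (+-monoʳ-< x B.p<m) (≮⇒≥ r≮m))
            x≤r′+m : x ≤ r′ + m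
            x≤r′+m = subst (x ≤_) (sym r′+m≡r) (m≤m+n x B.p)
            r′+m<x+p : r′ + m < x + A.p
            r′+m<x+p = subst (_< x + A.p) (sym r′+m≡r) (+-monoʳ-< x p′<p)
        ... | yes r<m with A.s ≤? r | B.s ≤? r
        ...   | yes s≤r | _ = 2≰1 v[r]≡2 (≤-reflexive (trans (same r) v′[r]≡1))
          where
            v[r]≡2 : A.v r ≡ 2
            v[r]≡2 = trans (A.v≡ r) (cong₂ _+_ inFirst[r] (A.inSecond-inside s≤r r<m))
            v′[r]≡1 : B.v r ≡ 1
            v′[r]≡1 = trans (B.v≡ r) (cong₂ _+_ inFirst′[r] (B.inSecond-inside (≤-trans (<⇒≤ s′<s) s≤r) r<m))
        ...   | no s≰r | no s′≰r = m<n⇒n≢0 (subst (1 ≤_) (sym v[r]≡1) (s≤s z≤n)) (trans (same r) v′[r]≡0)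
          where
            v[r]≡1 : A.v r ≡ 1
            v[r]≡1 = trans (A.v≡ r) (cong₂ _+_ inFirst[r] (A.inSecond-outside (≰⇒> s≰r)))
            v′[r]≡0 : B.v r ≡ 0
            v′[r]≡0 = trans (B.v≡ r) (cong₂ _+_ inFirst′[r] (B.inSecond-outside (≰⇒> s′≰r)))
        ...   | no _ | yes s′≤r = 2≰1 v′[s′]≡2 (subst (_≤ 1) (same B.s) v[s′]≤1)
          where
            v′[s′]≡2 : B.v B.s ≡ 2
            v′[s′]≡2 = trans (B.v≡ B.s) (cong₂ _+_
              (B.inFirst-inside B.x≤s (≤∧≢⇒< s′≤r s′≢r))
              (B.inSecond-inside ≤-refl (∸-monoʳ-< 1≤q′ B.q≤m)))
            v[s′]≤1 : A.v B.s ≤ 1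
            v[s′]≤1 = subst (_≤ 1) (sym (trans (A.v≡ B.s) (cong (A.inFirst B.s +_) (A.inSecond-outside s′<s))))
                            (subst (_≤ 1) (sym (+-identityʳ _)) (A.inFirst-≤1 B.s))

    canonical-injective : ∀ a {P P′} → Canonical P → Canonical P′ → SameCounts a P P′ → P ≡ P′
    canonical-injective a {q , x} {q′ , x′} c c′ same with <-cmp x x′
    ... | tri< x<x′ _ _ = contradiction x<x′ (x-determined a c c′ same)
    ... | tri> _ _ x′<x = contradiction x′<x (x-determined a c′ c (sym ∘ same))
    ... | tri≈ _ refl _ with <-cmp q q′
    ...   | tri< q<q′ _ _ = contradiction q<q′ (q-determined a c c′ same)
    ...   | tri> _ _ q′<q = contradiction q′<q (q-determined a c′ c (sym ∘ same))
    ...   | tri≈ _ refl _ = refl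

    HasCanonicalForm : Fin m → List (Fin m) → Set
    HasCanonicalForm a w = ∃ λ P → Canonical P × (w ↭ canonicalWord a P)

    module _ (a : Fin m) {p q : ℕ} (1≤p : 1 ≤ p) (p+q≡ℓ : p + q ≡ ℓ) where

      private
        s = m ∸ q
        q<ℓ : q < ℓ
        q<ℓ = subst (q <_) (trans (+-comm q p) p+q≡ℓ) (m<m+n q 1≤p)
        q≤m : q ≤ m
        q≤m = ≤-trans (<⇒≤ q<ℓ) (<⇒≤ ℓ<m)
        a⊞s⊞q≡a : a ⊞ s ⊞ q ≡ a
        a⊞s⊞q≡a = ⊞-m∸ a q q≤m

      join-after-second : 1 ≤ q → HasCanonicalForm a (run (a ⊞ 0) p ++ run (a ⊞ s) q)
      join-after-second 1≤q = (0 , s) , single (∸-monoʳ-< 1≤q q≤m) , (begin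
        run (a ⊞ 0) p ++ run (a ⊞ s) q   ↭⟨ ↭.++-comm (run (a ⊞ 0) p) (run (a ⊞ s) q) ⟩
        run (a ⊞ s) q ++ run (a ⊞ 0) p   ≡⟨ run-++ (a ⊞ s) q p (trans a⊞s⊞q≡a (sym (⊞-identityʳ a))) ⟩
        run (a ⊞ s) (q + p)              ≡⟨ cong (run (a ⊞ s)) (trans (+-comm q p) p+q≡ℓ) ⟩
        run (a ⊞ s) ℓ                    ≡⟨ ++-identityʳ _ ⟨
        canonicalWord a (0 , s)          ∎)
        where open PermutationReasoning

      join-before-second : HasCanonicalForm a (run (a ⊞ (m ∸ ℓ)) p ++ run (a ⊞ s) q)
      join-before-second = (0 , m ∸ ℓ) , single (∸-monoʳ-< 1≤ℓ (<⇒≤ ℓ<m)) , ↭-reflexive (begin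
        run (a ⊞ (m ∸ ℓ)) p ++ run (a ⊞ s) q  ≡⟨ run-++ (a ⊞ (m ∸ ℓ)) p q (trans (⊞-assoc a (m ∸ ℓ) p) (cong (a ⊞_) [m∸ℓ]+p≡s)) ⟩
        run (a ⊞ (m ∸ ℓ)) (p + q)             ≡⟨ cong (run (a ⊞ (m ∸ ℓ))) p+q≡ℓ ⟩
        run (a ⊞ (m ∸ ℓ)) ℓ                   ≡⟨ ++-identityʳ _ ⟨
        canonicalWord a (0 , m ∸ ℓ)           ∎)
        where
          open ≡-Reasoning
          [m∸ℓ]+p≡s : m ∸ ℓ + p ≡ s
          [m∸ℓ]+p≡s = +-cancelʳ-≡ q _ _ (begin
            m ∸ ℓ + p + q    ≡⟨ +-assoc (m ∸ ℓ) p q ⟩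
            m ∸ ℓ + (p + q)  ≡⟨ cong (m ∸ ℓ +_) p+q≡ℓ ⟩
            m ∸ ℓ + ℓ        ≡⟨ m∸n+n≡m (<⇒≤ ℓ<m) ⟩
            m                ≡⟨ m∸n+n≡m q≤m ⟨
            s + q            ∎)

      already-canonical : ∀ {x} → 1 ≤ q → 1 ≤ x → x + q ≤ m → x ≢ m ∸ ℓ →
                          HasCanonicalForm a (run (a ⊞ x) p ++ run (a ⊞ s) q)
      already-canonical {x} 1≤q 1≤x x+q≤m x≢m∸ℓ = (q , x) , split 1≤q q<ℓ 1≤x x+q≤m x+ℓ≢m ,
        ↭-reflexive (cong (λ n → run (a ⊞ x) n ++ run (a ⊞ s) q) (sym ℓ∸q≡p))
        where
          x+ℓ≢m : x + ℓ ≢ m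
          x+ℓ≢m x+ℓ≡m = x≢m∸ℓ (trans (sym (m+n∸n≡m x ℓ)) (cong (_∸ ℓ) x+ℓ≡m))
          ℓ∸q≡p : ℓ ∸ q ≡ p
          ℓ∸q≡p = trans (cong (_∸ q) (sym p+q≡ℓ)) (m+n∸n≡m p q)

      -- The first run starts inside the second; the pieces of the second run before and after
      -- that point are rearranged around the first run.
      rotate : ∀ {x} → x < m → m < x + q → HasCanonicalForm a (run (a ⊞ x) p ++ run (a ⊞ s) q)
      rotate {x} x<m m<x+q = (j , s) , split 1≤j (<-trans j<q q<ℓ) 1≤s s+j≤m s+ℓ≢m , (begin
        run (a ⊞ x) p ++ run (a ⊞ s) q                ≡⟨ cong (run (a ⊞ x) p ++_) second-run ⟩
        run (a ⊞ x) p ++ run (a ⊞ s) d ++ run (a ⊞ x) j  ↭⟨ shifts (run (a ⊞ x) p) (run (a ⊞ s) d) ⟩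
        run (a ⊞ s) d ++ run (a ⊞ x) p ++ run (a ⊞ x) j  ≡⟨ ++-assoc (run (a ⊞ s) d) _ _ ⟨
        (run (a ⊞ s) d ++ run (a ⊞ x) p) ++ run (a ⊞ x) j ≡⟨ cong (_++ run (a ⊞ x) j) (run-++ (a ⊞ s) d p a⊞s⊞d≡a⊞x) ⟩
        run (a ⊞ s) (d + p) ++ run (a ⊞ x) j           ≡⟨ cong₂ (λ n y → run (a ⊞ s) n ++ run (a ⊞ y) j) (sym ℓ∸j≡d+p) (sym m∸j≡x) ⟩
        canonicalWord a (j , s)                        ∎)
        where
          open PermutationReasoning
          j = m ∸ x
          d = q ∸ j
          x≤m = <⇒≤ x<m
          j<q : j < q
          j<q = subst (j <_) (m+n∸m≡n x q) (∸-monoˡ-< m<x+q x≤m)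
          d+j≡q : d + j ≡ q
          d+j≡q = m∸n+n≡m (<⇒≤ j<q)
          m∸j≡x : m ∸ j ≡ x
          m∸j≡x = m∸[m∸n]≡n x≤m
          s+q≡m : s + q ≡ m
          s+q≡m = m∸n+n≡m q≤m
          s+d≡x : s + d ≡ x
          s+d≡x = +-cancelʳ-≡ j _ _ (trans (+-assoc s d j) (trans (cong (s +_) d+j≡q) (trans s+q≡m (sym (m+[n∸m]≡n x≤m)))))
          ℓ∸j≡d+p : ℓ ∸ j ≡ d + p
          ℓ∸j≡d+p = trans (cong (_∸ j) (sym d+p+j≡ℓ)) (m+n∸n≡m (d + p) j)
            where
              d+p+j≡ℓ : d + p + j ≡ ℓ
              d+p+j≡ℓ = trans (cong (_+ j) (+-comm d p)) (trans (+-assoc p d j) (trans (cong (p +_) d+j≡q) p+q≡ℓ))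
          a⊞s⊞d≡a⊞x : a ⊞ s ⊞ d ≡ a ⊞ x
          a⊞s⊞d≡a⊞x = trans (⊞-assoc a s d) (cong (a ⊞_) s+d≡x)
          second-run : run (a ⊞ s) q ≡ run (a ⊞ s) d ++ run (a ⊞ x) j
          second-run = trans (cong (run (a ⊞ s)) (sym d+j≡q)) (trans (run-+ (a ⊞ s) d j) (cong (run (a ⊞ s) d ++_) (run-cong j a⊞s⊞d≡a⊞x)))
          1≤j : 1 ≤ j
          1≤j = m<n⇒0<n∸m x<m
          1≤s : 1 ≤ s
          1≤s = m<n⇒0<n∸m (<-trans q<ℓ ℓ<m)
          s+j≤m : s + j ≤ m
          s+j≤m = subst (s + j ≤_) s+q≡m (+-monoʳ-≤ s (<⇒≤ j<q))
          s+ℓ≢m : s + ℓ ≢ m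
          s+ℓ≢m s+ℓ≡m = <⇒≢ (subst (_< s + ℓ) s+q≡m (+-monoʳ-< s q<ℓ)) (sym s+ℓ≡m)

    normalise : ∀ a {x p q} → x < m → 1 ≤ p → p + q ≡ ℓ → HasCanonicalForm a (run (a ⊞ x) p ++ run (a ⊞ (m ∸ q)) q)
    normalise a {x} {p} {zero} x<m _ p+0≡ℓ =
      (0 , x) , single x<m , ↭-reflexive (cong (λ n → run (a ⊞ x) n ++ []) (trans (sym (+-identityʳ p)) p+0≡ℓ))
    normalise a {x} {p} {suc q} x<m 1≤p p+q≡ℓ with x ≟ 0 | x ≟ m ∸ ℓ | x + suc q ≤? m
    ... | yes refl | _        | _            = join-after-second a 1≤p p+q≡ℓ (s≤s z≤n)
    ... | no _     | yes refl | _            = join-before-second a 1≤p p+q≡ℓ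
    ... | no x≢0   | no x≢m∸ℓ | yes fits     = already-canonical a 1≤p p+q≡ℓ (s≤s z≤n) (n≢0⇒n>0 x≢0) fits x≢m∸ℓ
    ... | no _     | no _     | no overflows = rotate a 1≤p p+q≡ℓ x<m (≰⇒> overflows)

    lastLetter-canonical : ∀ {w U a} → TwoRuns (suc ℓ) w → w ≡ U ++ a ∷ [] → HasCanonicalForm a U
    lastLetter-canonical {U = U} {a} (twoRuns c p d zero 1≤p p+0≡1+ℓ) w≡ =
      subst (HasCanonicalForm a) U≡ (normalise a (∸-monoʳ-< 1≤ℓ (<⇒≤ ℓ<m)) 1≤ℓ (+-identityʳ ℓ))
      where
        split-last : run c ℓ ∷ʳ (c ⊞ ℓ) ≡ U ∷ʳ a
        split-last = trans (sym (run-∷ʳ c ℓ)) (trans (cong (run c) (sym (trans (sym (+-identityʳ p)) p+0≡1+ℓ)))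
                            (trans (sym (++-identityʳ (run c p))) w≡))
        c≡ : a ⊞ (m ∸ ℓ) ≡ c
        c≡ = trans (cong (_⊞ (m ∸ ℓ)) (sym (proj₂ (∷ʳ-injective (run c ℓ) U split-last)))) (⊞-∸-m c ℓ (<⇒≤ ℓ<m))
        U≡ : run (a ⊞ (m ∸ ℓ)) ℓ ++ [] ≡ U
        U≡ = trans (++-identityʳ _) (trans (run-cong ℓ c≡) (proj₁ (∷ʳ-injective (run c ℓ) U split-last)))
    lastLetter-canonical {U = U} {a} (twoRuns c p d (suc q) 1≤p p+1+q≡1+ℓ) w≡ =
      subst (HasCanonicalForm a) U≡ (normalise a (offset<m a c) 1≤p p+q≡ℓ)
      where
        p+q≡ℓ : p + q ≡ ℓ
        p+q≡ℓ = suc-injective (trans (sym (+-suc p q)) p+1+q≡1+ℓ)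
        q≤m : q ≤ m
        q≤m = ≤-trans (m≤n+m q p) (≤-trans (≤-reflexive p+q≡ℓ) (<⇒≤ ℓ<m))
        split-last : (run c p ++ run d q) ∷ʳ (d ⊞ q) ≡ U ∷ʳ a
        split-last = trans (++-assoc (run c p) (run d q) _) (trans (cong (run c p ++_) (sym (run-∷ʳ d q))) w≡)
        d≡ : a ⊞ (m ∸ q) ≡ d
        d≡ = trans (cong (_⊞ (m ∸ q)) (sym (proj₂ (∷ʳ-injective (run c p ++ run d q) U split-last)))) (⊞-∸-m d q q≤m)
        U≡ : run (a ⊞ offset a c) p ++ run (a ⊞ (m ∸ q)) q ≡ U
        U≡ = trans (cong₂ _++_ (run-cong p (⊞-offset a c)) (run-cong q d≡)) (proj₁ (∷ʳ-injective (run c p ++ run d q) U split-last))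

    -- Enumerating the canonical pairs

    splitOffsets : ℕ → List ℕ
    splitOffsets q = applyUpTo suc (m ∸ suc ℓ) ++ applyUpTo (λ k → m ∸ ℓ + suc k) (ℓ ∸ q)

    private
      m∸ℓ+ℓ≡m : m ∸ ℓ + ℓ ≡ m
      m∸ℓ+ℓ≡m = m∸n+n≡m (<⇒≤ ℓ<m)

      m∸ℓ≡1+[m∸1+ℓ] : m ∸ ℓ ≡ suc (m ∸ suc ℓ)
      m∸ℓ≡1+[m∸1+ℓ] = +-∸-assoc 1 ℓ<m

    ∈-splitOffsets⁻ : ∀ {q x} → q ≤ ℓ → x ∈ splitOffsets q → (1 ≤ x × x < m ∸ ℓ) ⊎ (m ∸ ℓ < x × x + q ≤ m)
    ∈-splitOffsets⁻ {q} q≤ℓ x∈ with ∈-++⁻ (applyUpTo suc (m ∸ suc ℓ)) x∈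
    ... | inj₁ x∈low with ∈-applyUpTo⁻ suc x∈low
    ...   | k , k<m∸1+ℓ , refl = inj₁ (s≤s z≤n , subst (suc k <_) (sym m∸ℓ≡1+[m∸1+ℓ]) (s≤s k<m∸1+ℓ))
    ∈-splitOffsets⁻ {q} q≤ℓ x∈ | inj₂ x∈high with ∈-applyUpTo⁻ (λ k → m ∸ ℓ + suc k) x∈high
    ...   | k , k<ℓ∸q , refl = inj₂ (m<m+n (m ∸ ℓ) z<s , (begin
      m ∸ ℓ + suc k + q    ≤⟨ +-monoˡ-≤ q (+-monoʳ-≤ (m ∸ ℓ) k<ℓ∸q) ⟩
      m ∸ ℓ + (ℓ ∸ q) + q  ≡⟨ +-assoc (m ∸ ℓ) (ℓ ∸ q) q ⟩
      m ∸ ℓ + (ℓ ∸ q + q)  ≡⟨ cong (m ∸ ℓ +_) (m∸n+n≡m q≤ℓ) ⟩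
      m ∸ ℓ + ℓ            ≡⟨ m∸ℓ+ℓ≡m ⟩
      m                    ∎))
      where open ≤-Reasoning

    ∈-splitOffsets⁺ : ∀ {q x} → 1 ≤ x → x + q ≤ m → x + ℓ ≢ m → x ∈ splitOffsets q
    ∈-splitOffsets⁺ {q} {suc x} _ x+q≤m x+ℓ≢m with <-cmp (suc x) (m ∸ ℓ)
    ... | tri< x<m∸ℓ _ _ = ∈-++⁺ˡ (∈-applyUpTo⁺ suc (s≤s⁻¹ (subst (suc x <_) m∸ℓ≡1+[m∸1+ℓ] x<m∸ℓ)))
    ... | tri≈ _ x≡m∸ℓ _ = contradiction (trans (cong (_+ ℓ) x≡m∸ℓ) m∸ℓ+ℓ≡m) x+ℓ≢m
    ... | tri> _ _ m∸ℓ<x = ∈-++⁺ʳ (applyUpTo suc (m ∸ suc ℓ))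
                             (subst (_∈ applyUpTo (λ k → m ∸ ℓ + suc k) (ℓ ∸ q)) m∸ℓ+[1+k]≡x (∈-applyUpTo⁺ (λ k → m ∸ ℓ + suc k) k<ℓ∸q))
      where
        k = suc x ∸ suc (m ∸ ℓ)
        m∸ℓ+[1+k]≡x : m ∸ ℓ + suc k ≡ suc x
        m∸ℓ+[1+k]≡x = trans (+-suc (m ∸ ℓ) k) (m+[n∸m]≡n m∸ℓ<x)
        1+k+q≤ℓ : suc k + q ≤ ℓ
        1+k+q≤ℓ = +-cancelˡ-≤ (m ∸ ℓ) _ _ (begin
          m ∸ ℓ + (suc k + q)  ≡⟨ +-assoc (m ∸ ℓ) (suc k) q ⟨
          m ∸ ℓ + suc k + q    ≡⟨ cong (_+ q) m∸ℓ+[1+k]≡x ⟩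
          suc x + q            ≤⟨ x+q≤m ⟩
          m                    ≡⟨ m∸ℓ+ℓ≡m ⟨
          m ∸ ℓ + ℓ            ∎)
          where open ≤-Reasoning
        k<ℓ∸q : k < ℓ ∸ q
        k<ℓ∸q = subst (_≤ ℓ ∸ q) (m+n∸n≡m (suc k) q) (∸-monoˡ-≤ q 1+k+q≤ℓ)

    splitOffsets-unique : ∀ q → Unique (splitOffsets q)
    splitOffsets-unique q = Unique.++⁺
      (Unique.applyUpTo⁺₁ suc _ (λ i<j _ → <⇒≢ i<j ∘ suc-injective))
      (Unique.applyUpTo⁺₁ _ _ (λ i<j _ → <⇒≢ i<j ∘ suc-injective ∘ +-cancelˡ-≡ (m ∸ ℓ) _ _))
      λ (x∈low , x∈high) → disjoint x∈low x∈high
      where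
        disjoint : ∀ {x} → x ∈ applyUpTo suc (m ∸ suc ℓ) → x ∉ applyUpTo (λ k → m ∸ ℓ + suc k) (ℓ ∸ q)
        disjoint x∈low x∈high with ∈-applyUpTo⁻ suc x∈low | ∈-applyUpTo⁻ _ x∈high
        ... | k , k< , refl | k′ , _ , 1+k≡ = <⇒≱ (subst (suc k <_) (sym m∸ℓ≡1+[m∸1+ℓ]) (s≤s k<))
                                                (subst (m ∸ ℓ ≤_) (sym 1+k≡) (m≤m+n (m ∸ ℓ) (suc k′)))

    length-splitOffsets : ∀ {q} → q ≤ ℓ → length (splitOffsets q) + suc q ≡ m
    length-splitOffsets {q} q≤ℓ = begin
      length (splitOffsets q) + suc q                ≡⟨ cong (_+ suc q) (length-++ (applyUpTo suc (m ∸ suc ℓ))) ⟩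
      length (applyUpTo suc (m ∸ suc ℓ)) + length (applyUpTo _ (ℓ ∸ q)) + suc q
        ≡⟨ cong₂ (λ i j → i + j + suc q) (length-applyUpTo suc (m ∸ suc ℓ)) (length-applyUpTo _ (ℓ ∸ q)) ⟩
      m ∸ suc ℓ + (ℓ ∸ q) + suc q                    ≡⟨ +-assoc (m ∸ suc ℓ) (ℓ ∸ q) (suc q) ⟩
      m ∸ suc ℓ + (ℓ ∸ q + suc q)                    ≡⟨ cong (m ∸ suc ℓ +_) (trans (+-suc (ℓ ∸ q) q) (cong suc (m∸n+n≡m q≤ℓ))) ⟩
      m ∸ suc ℓ + suc ℓ                              ≡⟨ m∸n+n≡m ℓ<m ⟩
      m                                              ∎
      where open ≡-Reasoning

    canonicalUpTo : ℕ → List (ℕ × ℕ)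
    canonicalUpTo zero    = map (0 ,_) (upTo m)
    canonicalUpTo (suc n) = canonicalUpTo n ++ map (suc n ,_) (splitOffsets (suc n))

    canonicalUpTo-fst : ∀ {n P} → P ∈ canonicalUpTo n → proj₁ P ≤ n
    canonicalUpTo-fst {zero} P∈ with ∈-map⁻ (0 ,_) P∈
    ... | _ , _ , refl = z≤n
    canonicalUpTo-fst {suc n} P∈ with ∈-++⁻ (canonicalUpTo n) P∈
    ... | inj₁ P∈earlier = m≤n⇒m≤1+n (canonicalUpTo-fst P∈earlier)
    ... | inj₂ P∈last with ∈-map⁻ (suc n ,_) P∈last
    ...   | _ , _ , refl = ≤-refl

    canonicalUpTo-sound : ∀ {n P} → n < ℓ → P ∈ canonicalUpTo n → Canonical P
    canonicalUpTo-sound {zero} _ P∈ with ∈-map⁻ (0 ,_) P∈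
    ... | x , x∈ , refl = single (∈-upTo⁻ x∈)
    canonicalUpTo-sound {suc n} n<ℓ P∈ with ∈-++⁻ (canonicalUpTo n) P∈
    ... | inj₁ P∈earlier = canonicalUpTo-sound (<-trans (n<1+n n) n<ℓ) P∈earlier
    ... | inj₂ P∈last with ∈-map⁻ (suc n ,_) P∈last
    ...   | x , x∈ , refl with ∈-splitOffsets⁻ (<⇒≤ n<ℓ) x∈
    ...     | inj₁ (1≤x , x<m∸ℓ) = split (s≤s z≤n) n<ℓ 1≤x
                (subst (x + suc n ≤_) m∸ℓ+ℓ≡m (<⇒≤ (+-mono-< x<m∸ℓ n<ℓ)))
                (<⇒≢ (subst (x + ℓ <_) m∸ℓ+ℓ≡m (+-monoˡ-< ℓ x<m∸ℓ)))
    ...     | inj₂ (m∸ℓ<x , x+q≤m) = split (s≤s z≤n) n<ℓ (<-≤-trans z<s m∸ℓ<x) x+q≤m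
                (<⇒≢ (subst (_< x + ℓ) m∸ℓ+ℓ≡m (+-monoˡ-< ℓ m∸ℓ<x)) ∘ sym)

    canonicalUpTo-complete : ∀ {n q x} → Canonical (q , x) → q ≤ n → (q , x) ∈ canonicalUpTo n
    canonicalUpTo-complete {zero}  (single x<m) _ = ∈-map⁺ (0 ,_) (∈-upTo⁺ x<m)
    canonicalUpTo-complete {suc n} (single x<m) _ = ∈-++⁺ˡ (canonicalUpTo-complete {n} (single x<m) z≤n)
    canonicalUpTo-complete {zero}  (split 1≤q _ _ _ _) q≤0 = contradiction (≤-trans 1≤q q≤0) λ ()
    canonicalUpTo-complete {suc n} {q} c@(split _ _ 1≤x x+q≤m x+ℓ≢m) q≤1+n with q ≟ suc n
    ... | yes refl = ∈-++⁺ʳ (canonicalUpTo n) (∈-map⁺ (suc n ,_) (∈-splitOffsets⁺ 1≤x x+q≤m x+ℓ≢m))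
    ... | no q≢1+n = ∈-++⁺ˡ (canonicalUpTo-complete c (s≤s⁻¹ (≤∧≢⇒< q≤1+n q≢1+n)))

    canonicalUpTo-unique : ∀ n → Unique (canonicalUpTo n)
    canonicalUpTo-unique zero    = Unique.map⁺ (cong proj₂) (Unique.upTo⁺ m)
    canonicalUpTo-unique (suc n) = Unique.++⁺ (canonicalUpTo-unique n) (Unique.map⁺ (cong proj₂) (splitOffsets-unique (suc n)))
      λ (P∈earlier , P∈last) → disjoint P∈earlier P∈last
      where
        disjoint : ∀ {P} → P ∈ canonicalUpTo n → P ∉ map (suc n ,_) (splitOffsets (suc n))
        disjoint P∈earlier P∈last with ∈-map⁻ (suc n ,_) P∈last
        ... | _ , _ , refl = 1+n≰n (canonicalUpTo-fst P∈earlier)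

    length-canonicalUpTo : ∀ {n} → n < ℓ → 2 * length (canonicalUpTo n) + n * (n + 3) ≡ 2 * suc n * m
    length-canonicalUpTo {zero} _ = begin
      2 * length (canonicalUpTo 0) + 0      ≡⟨ cong (λ k → 2 * k + 0) (trans (length-map _ (upTo m)) (length-upTo m)) ⟩
      2 * m + 0                             ≡⟨ +-identityʳ (2 * m) ⟩
      2 * 1 * m                             ∎
      where open ≡-Reasoning
    length-canonicalUpTo {suc n} n<ℓ = begin
      2 * length (canonicalUpTo n ++ block) + suc n * (suc n + 3) ≡⟨ cong (λ k → 2 * k + suc n * (suc n + 3)) length-step ⟩
      2 * (L + b) + suc n * (suc n + 3)                  ≡⟨ regroup L b n ⟩
      (2 * L + n * (n + 3)) + 2 * (b + suc (suc n))      ≡⟨ cong₂ (λ i j → i + 2 * j) (length-canonicalUpTo (<-trans (n<1+n n) n<ℓ)) (length-splitOffsets (<⇒≤ n<ℓ)) ⟩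
      2 * suc n * m + 2 * m                              ≡⟨ collect n m ⟩
      2 * suc (suc n) * m                                ∎
      where
        open ≡-Reasoning
        block = map (suc n ,_) (splitOffsets (suc n))
        length-step : length (canonicalUpTo n ++ block) ≡ length (canonicalUpTo n) + length (splitOffsets (suc n))
        length-step = trans (length-++ (canonicalUpTo n)) (cong (length (canonicalUpTo n) +_) (length-map _ (splitOffsets (suc n))))
        L = length (canonicalUpTo n)
        b = length (splitOffsets (suc n))
        regroup : ∀ L b n → 2 * (L + b) + suc n * (suc n + 3) ≡ (2 * L + n * (n + 3)) + 2 * (b + suc (suc n))
        regroup = solve-∀
        collect : ∀ n m → 2 * suc n * m + 2 * m ≡ 2 * suc (suc n) * m
        collect = solve-∀

    canonicals : List (ℕ × ℕ)
    canonicals = canonicalUpTo (ℓ ∸ 1)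

    private
      ℓ∸1<ℓ : ℓ ∸ 1 < ℓ
      ℓ∸1<ℓ = ∸-monoʳ-< z<s 1≤ℓ

    ∈-canonicals⁻ : ∀ {P} → P ∈ canonicals → Canonical P
    ∈-canonicals⁻ = canonicalUpTo-sound ℓ∸1<ℓ

    ∈-canonicals⁺ : ∀ {P} → Canonical P → P ∈ canonicals
    ∈-canonicals⁺ c = canonicalUpTo-complete c (<⇒≤pred (canonical-q<ℓ c))

    length-canonicals : 2 * length canonicals + ℓ * (ℓ ∸ 1) ≡ 2 * (1 + ℓ * m ∸ ℓ)
    length-canonicals = 2*L+ℓ*[ℓ∸1]≡2*[1+ℓ*m∸ℓ] {L = length canonicals} 0<m 1≤ℓ (length-canonicalUpTo ℓ∸1<ℓ)

    module _ (1<m : 1 < m) where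

      canonicalWord-factor : ∀ a {P} → Canonical P → ∃ λ i → factorAt m i (suc ℓ) ≡ canonicalWord a P ++ a ∷ []
      canonicalWord-factor a {q , x} c = twoRuns-factor 1<m ℓ<m (subst (TwoRuns (suc ℓ)) word≡
        (twoRuns (a ⊞ x) (ℓ ∸ q) (a ⊞ (m ∸ q)) (suc q) (m<n⇒0<n∸m q<ℓ)
                 (trans (+-suc (ℓ ∸ q) q) (cong suc (m∸n+n≡m (<⇒≤ q<ℓ))))))
        where
          q<ℓ = canonical-q<ℓ c
          word≡ : run (a ⊞ x) (ℓ ∸ q) ++ run (a ⊞ (m ∸ q)) (suc q) ≡ canonicalWord a (q , x) ++ a ∷ []
          word≡ = trans (cong (run (a ⊞ x) (ℓ ∸ q) ++_) (trans (run-∷ʳ (a ⊞ (m ∸ q)) q)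
                          (cong (run (a ⊞ (m ∸ q)) q ∷ʳ_) (⊞-m∸ a q (≤-trans (<⇒≤ q<ℓ) (<⇒≤ ℓ<m))))))
                        (sym (++-assoc (run (a ⊞ x) (ℓ ∸ q)) _ _))

      InYR⇒canonical : ∀ {v a} → InYR m ℓ (v , a) → ∃ λ P → Canonical P × v ≡ Ψ m (canonicalWord a P)
      InYR⇒canonical (U , i , factor≡ , Ψ≡) with lastLetter-canonical (factor-twoRuns 1<m ℓ<m i) factor≡
      ... | P , c , U↭ = P , c , trans (sym Ψ≡) (Ψ-↭ U↭)

      encodeR : Fin m × (ℕ × ℕ) → Vec ℕ m × Fin m
      encodeR (a , P) = Ψ m (canonicalWord a P) , a

      YR-hasSize : HasSize (InYR m ℓ) (m * length canonicals)
      YR-hasSize =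
        map encodeR pairs , Unique-map⁺ encodeR-injective pairs-unique , (λ y → mk⇔ (sound y) (complete y)) , size
        where
          pairs = cartesianProduct (allFin m) canonicals
          pairs-unique : Unique pairs
          pairs-unique = Unique.cartesianProduct⁺ (Unique.allFin⁺ m) (canonicalUpTo-unique (ℓ ∸ 1))
          canonical-of : ∀ {a P} → (a , P) ∈ pairs → Canonical P
          canonical-of aP∈ = ∈-canonicals⁻ (proj₂ (∈-cartesianProduct⁻ (allFin m) canonicals aP∈))
          encodeR-injective : ∀ {aP bQ} → aP ∈ pairs → bQ ∈ pairs → encodeR aP ≡ encodeR bQ → aP ≡ bQ
          encodeR-injective {a , P} {b , Q} aP∈ bQ∈ e with cong proj₂ e
          ... | refl = cong (a ,_) (canonical-injective a (canonical-of aP∈) (canonical-of bQ∈)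
                         (λ r → Ψ≡⇒count≡ {canonicalWord a P} {canonicalWord a Q} (cong proj₁ e) (a ⊞ r)))
          sound : ∀ y → y ∈ map encodeR pairs → InYR m ℓ y
          sound y y∈ with ∈-map⁻ encodeR y∈
          ... | (a , P) , aP∈ , refl with canonicalWord-factor a (canonical-of aP∈)
          ...   | i , factor≡ = canonicalWord a P , i , factor≡ , refl
          complete : ∀ y → InYR m ℓ y → y ∈ map encodeR pairs
          complete (v , a) inY with InYR⇒canonical inY
          ... | P , c , refl = ∈-map⁺ encodeR (∈-cartesianProduct⁺ (∈-allFin a) (∈-canonicals⁺ c))
          size : length (map encodeR pairs) ≡ m * length canonicals
          size = trans (length-map encodeR pairs) (trans (length-cartesianProduct (allFin m) canonicals)
                   (cong (_* length canonicals) (length-tabulate {n = m} (λ i → i))))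

      revnegR : Vec ℕ m × Fin m → Fin m × Vec ℕ m
      revnegR (v , a) = neg a , negv v

      revnegL : Fin m × Vec ℕ m → Vec ℕ m × Fin m
      revnegL (b , w) = negv w , neg b

      InYR⇒InYL : ∀ y → InYR m ℓ y → InYL m ℓ (revnegR y)
      InYR⇒InYL (v , a) (U , i , factor≡ , Ψ≡) with factor-revneg 1<m ℓ<m (i , factor≡)
      ... | j , factor≡′ = revneg U , j , trans factor≡′ (revneg-++ U (a ∷ [])) , trans (Ψ-revneg U) (cong negv Ψ≡)

      InYL⇒InYR : ∀ y → InYL m ℓ y → InYR m ℓ (revnegL y)
      InYL⇒InYR (b , w) (U , i , factor≡ , Ψ≡) with factor-revneg 1<m ℓ<m (i , factor≡)
      ... | j , factor≡′ = revneg U , j , trans factor≡′ (revneg-++ (b ∷ []) U) , trans (Ψ-revneg U) (cong negv Ψ≡)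

      YL-hasSize : HasSize (InYL m ℓ) (m * length canonicals)
      YL-hasSize = HasSize-bijection revnegR revnegL
        (λ (v , a) → cong₂ _,_ (negv-involutive v) (neg-involutive a))
        (λ (b , w) → cong₂ _,_ (neg-involutive b) (negv-involutive w))
        InYR⇒InYL InYL⇒InYR YR-hasSize

proposition9p5 : (m ℓ : ℕ) .{{_ : NonZero m}} → 2 ≤ m → 1 ≤ ℓ → ℓ < m →
    HasSize (InYR m ℓ) (m * (1 + ℓ * m ∸ ℓ) ∸ (m * (ℓ * (ℓ ∸ 1))) / 2)
    × HasSize (InYL m ℓ) (m * (1 + ℓ * m ∸ ℓ) ∸ (m * (ℓ * (ℓ ∸ 1))) / 2)
    × HasSize (InY m ℓ) (2 * m * (1 + ℓ * m ∸ ℓ) ∸ m * ℓ * (ℓ ∸ 1))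
proposition9p5 m ℓ 2≤m 1≤ℓ ℓ<m =
  subst (HasSize (InYR m ℓ)) sizeR YR ,
  subst (HasSize (InYL m ℓ)) sizeR YL ,
  subst (HasSize (InY m ℓ)) sizeY (HasSize-⊎ YR YL)
  where
    YR = YR-hasSize m ℓ 1≤ℓ ℓ<m 2≤m
    YL = YL-hasSize m ℓ 1≤ℓ ℓ<m 2≤m
    counted = length-canonicals m ℓ 1≤ℓ ℓ<m
    sizeR = m*L≡m*A∸[m*D]/2 m counted
    sizeY = trans (m*L+m*L≡2*m*A∸m*D m counted) (cong (2 * m * (1 + ℓ * m ∸ ℓ) ∸_) (sym (*-assoc m ℓ (ℓ ∸ 1))))
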